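{- Let $n>1$ be an integer, $p$ a prime and $\mathbf{a}=(a_1,a_2,a_3)\in(\mathbb{Q}_p^\times)^3$. (i) If $\#\{[v_p(a_i)]_n : i\in\{1,2,3\}\}=3$, then $\mathcal{C}_{n,\mathbf{a}}(\mathbb{Q}_p)=\emptyset$. (ii) If $\#\{[v_p(a_i)]_n : i\in\{1,2,3\}\}\le 2$, let $\mathbf{b}=(b_1,b_2,b_3)$ be the minimised triple associated to $\mathbf{a}$. Then $\mathcal{C}_{n,\mathbf{a}}(\mathbb{Q}_p)\neq\emptyset$ if and only if there exists $\mathbf{t}=(t_1,t_2,t_3)\in\mathbb{Z}_p^3$ such that (1) $\mathbf{t}\not\equiv(0,0,c)\bmod p$ for every $c\in\mathbb{Z}/p\mathbb{Z}$, and (2) $b_1t_1^n+b_2t_2^n+b_3t_3^n\equiv 0\bmod p^{2v_p(n)+1}$.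
   Context: For $a\in\mathbb{Z}$, $[a]_n\in\{0,\dots,n-1\}$ denotes the representative of $a\bmod n$. For a field $F$ and $\mathbf{a}\in F^3$, $\mathcal{C}_{n,\mathbf{a}}$ is the projective plane curve $a_1t_1^n+a_2t_2^n+a_3t_3^n=0$ in $\mathbb{P}^2_F$. For $\mathbf{a}\in(\mathbb{Q}_p^\times)^3$ with $\#\{[v_p(a_i)]_n\}\le2$, choose indices $i<j$ with $[v_p(a_i)]_n=[v_p(a_j)]_n$ and let $k$ be the remaining index; the associated minimised triple $\mathbf{b}=(b_1,b_2,b_3)\in\mathbb{Z}_p^3$ is $b_1=a_i/p^{v_p(a_i)}$, $b_2=a_j/p^{v_p(a_j)}$, $b_3=a_k/p^{\,v_p(a_k)-[v_p(a_k)-v_p(a_i)]_n}$. -}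

module Defs where

open import Data.Nat as ℕ using (ℕ; zero; suc)
open import Data.Nat.Divisibility as ℕD using (_∣?_)
open import Data.Integer using (ℤ; +_; -[1+_]; _+_; _*_; _-_; _^_; _%ℕ_)
open import Data.Integer.Divisibility using (_∣_)
open import Data.Fin using (Fin)
open import Data.Product using (_×_; _,_; Σ; ∃; proj₁)
open import Data.Sum using (_⊎_)
open import Relation.Nullary using (¬_; yes; no)

-- p-adic integers as coherent sequences of integers:
-- x represents the p-adic integer with x k ≡ (that integer) mod p^k,
-- coherence: x (k+1) ≡ x k  (mod p^k).

Seq : Set
Seq = ℕ → ℤ

P : ℕ → ℕ → ℤ
P p m = (+ p) ^ m

IsZp : ℕ → Seq → Set
IsZp p x = ∀ k → P p k ∣ (x (suc k) - x k)

record ℤₚ (p : ℕ) : Set where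
  constructor mkℤₚ
  field
    seq : Seq
    coh : IsZp p seq
open ℤₚ public

IsZeroZp : ℕ → Seq → Set
IsZeroZp p x = ∀ k → P p k ∣ x k

-- x ≠ 0 in ℤ_p (constructive apartness from 0; classically equivalent)
NonZeroZp : ℕ → Seq → Set
NonZeroZp p x = ∃ λ k → ¬ (P p k ∣ x k)

record ℤₚˣ (p : ℕ) : Set where
  constructor mkℤₚˣ
  field
    elt  : ℤₚ p
    unit : ¬ (P p 1 ∣ seq elt 1)
open ℤₚˣ public

-- ℚ_p = ℤ_p[1/p] : pair (x , m) stands for x / p^m.
-- Raw (sequence-level) ring operations; equality to zero is IsZeroZp
-- of the numerator.

RawQ : Set
RawQ = Seq × ℕ

addQ : ℕ → RawQ → RawQ → RawQ
addQ p (x , m) (y , m') = (λ k → x k * P p m' + y k * P p m) , (m ℕ.+ m')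

mulQ : RawQ → RawQ → RawQ
mulQ (x , m) (y , m') = (λ k → x k * y k) , (m ℕ.+ m')

oneQ : RawQ
oneQ = (λ _ → + 1) , 0

powQ : RawQ → ℕ → RawQ
powQ x zero    = oneQ
powQ x (suc n) = mulQ x (powQ x n)

IsZeroQ : ℕ → RawQ → Set
IsZeroQ p (x , _) = IsZeroZp p x

-- ℚ_p^× via the canonical decomposition a = p^v · u, v ∈ ℤ, u ∈ ℤ_p^×;
-- val is v_p(a).
record ℚₚˣ (p : ℕ) : Set where
  constructor mkℚₚˣ
  field
    val  : ℤ
    upart : ℤₚˣ p
open ℚₚˣ public

toQ : ∀ {p} → ℕ → ℚₚˣ p → RawQ
toQ p (mkℚₚˣ (+ e) u)     = (λ k → P p e * seq (elt u) k) , 0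
toQ p (mkℚₚˣ -[1+ m ] u)  = seq (elt u) , suc m

-- an element of ℚ_p given as x / p^m with x ∈ ℤ_p
ℚₚ : ℕ → Set
ℚₚ p = ℤₚ p × ℕ

rawOf : ∀ {p} → ℚₚ p → RawQ
rawOf (x , m) = seq x , m

-- C_{n,a}(ℚ_p) ≠ ∅ : a point (t1:t2:t3) of P^2(ℚ_p), i.e. a triple
-- not all zero, with a1 t1^n + a2 t2^n + a3 t3^n = 0.

open import Data.Fin using () renaming (zero to f0; suc to fs)

curveVal : (p n : ℕ) → (Fin 3 → ℚₚˣ p) → (Fin 3 → ℚₚ p) → RawQ
curveVal p n a t = addQ p (addQ p (term f0) (term (fs f0))) (term (fs (fs f0)))
  where
    term : Fin 3 → RawQ
    term i = mulQ (toQ p (a i)) (powQ (rawOf (t i)) n)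

HasQpPoint : (p n : ℕ) → (Fin 3 → ℚₚˣ p) → Set
HasQpPoint p n a =
  Σ (Fin 3 → ℚₚ p) λ t →
    (Σ (Fin 3) λ i → NonZeroZp p (seq (proj₁ (t i)))) ×
    IsZeroQ p (curveVal p n a t)

-- [a]_n ∈ {0,…,n-1}  (only used for n > 1)
res : ℕ → ℤ → ℕ
res zero    a = 0
res (suc n) a = a %ℕ suc n

-- v_p(m) for a natural number m ≥ 1 (largest k with p^k ∣ m), p ≥ 2;
-- computed with fuel m (enough since v_p(m) ≤ m).
vpℕ : ℕ → ℕ → ℕ
vpℕ p m = go m p m
  where
    go : ℕ → ℕ → ℕ → ℕ
    go zero    _       _ = 0
    go (suc f) zero    _ = 0
    go (suc f) (suc q) m with suc q ∣? m
    ... | yes _ = suc (go f (suc q) (m ℕ./ suc q))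
    ... | no  _ = 0

-- minimised triple b for the choice (i , j , k):
-- b1 = a_i / p^{v(a_i)}, b2 = a_j / p^{v(a_j)},
-- b3 = a_k / p^{v(a_k) - [v(a_k) - v(a_i)]_n} = p^{[v(a_k)-v(a_i)]_n} · u_k
minB : (p n : ℕ) → (Fin 3 → ℚₚˣ p) → (i j k : Fin 3) → Fin 3 → Seq
minB p n a i j k f0           = seq (elt (upart (a i)))
minB p n a i j k (fs f0)      = seq (elt (upart (a j)))
minB p n a i j k (fs (fs f0)) = λ l → P p (res n (val (a k) - val (a i))) * seq (elt (upart (a k))) l

-- b1 t1^n + b2 t2^n + b3 t3^n at level N (determines it mod p^N)
minVal : (p n : ℕ) → (Fin 3 → ℚₚˣ p) → (i j k : Fin 3) → (Fin 3 → ℤₚ p) → ℕ → ℤ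
minVal p n a i j k t N =
  b f0 N * seq (t f0) N ^ n + b (fs f0) N * seq (t (fs f0)) N ^ n
    + b (fs (fs f0)) N * seq (t (fs (fs f0))) N ^ n
  where b = minB p n a i j k

{-# OPTIONS --safe #-}
module Submission where

-- Clearing denominators turns a ℚ_p-point into a primitive solution x ∈ ℤ_p³ of
-- Σ p^(e_l) u_l x_l^n = 0 with units u_l and e_l ≡ v_p(a_l) + s (mod n) for a common shift s.
-- Read x at a high precision and write x_l = p^(w_l) z_l; the l-th term then has valuation
-- e_l + n w_l. If the e_l are pairwise incongruent mod n the least valuation is attained exactly
-- once, so the terms cannot cancel: this is (i). Otherwise dividing by the least power of p leaves
-- b_1 y_1^n + b_2 y_2^n + b_3 y_3^n ≡ 0 with some y_l a unit, and since b_3 = p^r u_k with r < n,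
-- y_1 or y_2 is a unit: this is (ii) ⇒. Conversely, at a unit y_1 the derivative of b_1 y^n has
-- valuation exactly v_p(n), so Hensel's lemma lifts a solution modulo p^(2 v_p(n) + 1) to an exact
-- one, and rescaling the coordinates by powers of p turns it back into a point of C_{n,a}.

open import Defs
open import Data.Nat using (ℕ; _<_)
open import Data.Nat.Primality using (Prime)
open import Data.Integer using (ℤ; +_; _-_)
open import Data.Integer.Divisibility using (_∣_)
open import Data.Fin using (Fin) renaming (_<_ to _<ᶠ_; zero to f0; suc to fs)
open import Data.Product using (_×_; Σ; ∃)
open import Relation.Nullary using (¬_)
open import Relation.Binary.PropositionalEquality using (_≡_; _≢_)
open import Function.Bundles using (_⇔_)

open import Data.Nat as ℕ using (zero; suc; z≤n; s≤s)
import Data.Nat.Properties as ℕP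
import Data.Nat.Divisibility as ℕD
import Data.Nat.DivMod as ℕDM
import Data.Nat.Coprimality as ℕC
import Data.Nat.GCD as ℕG
import Data.Nat.Tactic.RingSolver as ℕSolver
open import Data.Nat.Primality using (euclidsLemma; prime⇒irreducible; prime⇒nonTrivial)
open import Data.Integer as ℤ using (-[1+_]; _+_; _*_; -_; _^_; 0ℤ; 1ℤ; _%ℕ_; _/ℕ_)
import Data.Integer.Properties as ℤP
import Data.Integer.DivMod as ℤDM
import Data.Integer.Divisibility as UD
open import Data.Integer.Divisibility.Signed as SD using (divides; ∣ᵤ⇒∣; ∣⇒∣ᵤ) renaming (_∣_ to _∣ₛ_)
open import Data.Integer.Tactic.RingSolver using (solve-∀)
open import Data.Product using (_,_; proj₁; proj₂)
open import Data.Sum as Sum using (_⊎_; inj₁; inj₂)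
open import Data.Empty using (⊥; ⊥-elim)
open import Data.Vec.Functional using (updateAt)
open import Data.Vec.Functional.Properties using (updateAt-updates; map-updateAt-local)
open import Function using (_∘_)
open import Function.Bundles using (mk⇔)
open import Relation.Nullary using (yes; no)
open import Relation.Binary.PropositionalEquality

infix 4 _≡_mod_

record _≡_mod_ (a b d : ℤ) : Set where
  constructor ≡-mod
  field
    ∣-difference : d ∣ₛ a - b

open _≡_mod_ public

module _ {d : ℤ} where

  ∣0 : d ∣ₛ 0ℤ
  ∣0 = divides 0ℤ (sym (ℤP.*-zeroˡ d))

  ≡-mod-reflexive : ∀ {a b} → a ≡ b → a ≡ b mod d
  ≡-mod-reflexive {a} refl = ≡-mod (subst (d ∣ₛ_) (sym (ℤP.+-inverseʳ a)) ∣0)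

  ≡-mod-refl : ∀ {a} → a ≡ a mod d
  ≡-mod-refl = ≡-mod-reflexive refl

  ≡-mod-sym : ∀ {a b} → a ≡ b mod d → b ≡ a mod d
  ≡-mod-sym {a} {b} (≡-mod h) = ≡-mod (subst (d ∣ₛ_) (negate-difference a b) (SD.∣m⇒∣-m h))
    where
    negate-difference : ∀ a b → - (a - b) ≡ b - a
    negate-difference = solve-∀

  ≡-mod-trans : ∀ {a b c} → a ≡ b mod d → b ≡ c mod d → a ≡ c mod d
  ≡-mod-trans {a} {b} {c} (≡-mod h₁) (≡-mod h₂) =
    ≡-mod (subst (d ∣ₛ_) (telescope a b c) (SD.∣m∣n⇒∣m+n h₁ h₂))
    where
    telescope : ∀ a b c → (a - b) + (b - c) ≡ a - c
    telescope = solve-∀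

  +-cong-mod : ∀ {a a' b b'} → a ≡ a' mod d → b ≡ b' mod d → a + b ≡ a' + b' mod d
  +-cong-mod {a} {a'} {b} {b'} (≡-mod h₁) (≡-mod h₂) =
    ≡-mod (subst (d ∣ₛ_) (regroup a a' b b') (SD.∣m∣n⇒∣m+n h₁ h₂))
    where
    regroup : ∀ a a' b b' → (a - a') + (b - b') ≡ (a + b) - (a' + b')
    regroup = solve-∀

  *-cong-mod : ∀ {a a' b b'} → a ≡ a' mod d → b ≡ b' mod d → a * b ≡ a' * b' mod d
  *-cong-mod {a} {a'} {b} {b'} (≡-mod h₁) (≡-mod h₂) =
    ≡-mod (subst (d ∣ₛ_) (regroup a a' b b') (SD.∣m∣n⇒∣m+n (SD.∣n⇒∣m*n a h₂) (SD.∣m⇒∣m*n b' h₁)))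
    where
    regroup : ∀ a a' b b' → a * (b - b') + (a - a') * b' ≡ a * b - a' * b'
    regroup = solve-∀

  ^-cong-mod : ∀ {a a'} → a ≡ a' mod d → ∀ n → a ^ n ≡ a' ^ n mod d
  ^-cong-mod h zero    = ≡-mod-refl
  ^-cong-mod h (suc n) = *-cong-mod h (^-cong-mod h n)

  ∣-resp-≡-mod : ∀ {a b} → a ≡ b mod d → d ∣ₛ b → d ∣ₛ a
  ∣-resp-≡-mod {a} {b} (≡-mod h) d∣b = subst (d ∣ₛ_) (cancel a b) (SD.∣m∣n⇒∣m+n h d∣b)
    where
    cancel : ∀ a b → (a - b) + b ≡ a
    cancel = solve-∀

≡-mod-∣ : ∀ {a b d e} → e ∣ₛ d → a ≡ b mod d → a ≡ b mod e
≡-mod-∣ e∣d (≡-mod h) = ≡-mod (SD.∣-trans e∣d h)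

+-cancelʳ-≡-mod : ∀ {a b s d} → a + s ≡ b + s mod d → a ≡ b mod d
+-cancelʳ-≡-mod {a} {b} {s} {d} (≡-mod h) = ≡-mod (subst (d ∣ₛ_) (cancel a b s) h)
  where
  cancel : ∀ a b s → (a + s) - (b + s) ≡ a - b
  cancel = solve-∀

minus-cong-mod : ∀ {a a' b b' d} → a ≡ a' mod d → b ≡ b' mod d → a - b ≡ a' - b' mod d
minus-cong-mod {a} {a'} {b} {b'} {d} (≡-mod h₁) (≡-mod h₂) =
  ≡-mod (subst (d ∣ₛ_) (regroup a a' b b') (SD.∣m∣n⇒∣m-n h₁ h₂))
  where
  regroup : ∀ a a' b b' → (a - a') - (b - b') ≡ (a - b) - (a' - b')
  regroup = solve-∀

x-y≡z⇒x≡y+z-mod : ∀ {x y z d} → x - y ≡ z mod d → x ≡ y + z mod d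
x-y≡z⇒x≡y+z-mod {x} {y} {z} {d} (≡-mod h) = ≡-mod (subst (d ∣ₛ_) (regroup x y z) h)
  where
  regroup : ∀ x y z → x - y - z ≡ x - (y + z)
  regroup = solve-∀

^-distrib-* : ∀ a b n → (a * b) ^ n ≡ a ^ n * b ^ n
^-distrib-* a b zero    = refl
^-distrib-* a b (suc n) = trans (cong ((a * b) *_) (^-distrib-* a b n)) (interchange a b (a ^ n) (b ^ n))
  where
  interchange : ∀ a b c d → (a * b) * (c * d) ≡ (a * c) * (b * d)
  interchange = solve-∀

P-+ : ∀ p a b → P p (a ℕ.+ b) ≡ P p a * P p b
P-+ p = ℤP.^-distribˡ-+-* (+ p)

P-mono-∣ : ∀ p {a b} → a ℕ.≤ b → P p a ∣ₛ P p b
P-mono-∣ p {a} {b} a≤b = divides (P p (b ℕ.∸ a))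
  (trans (cong (P p) (sym (ℕP.m∸n+n≡m a≤b))) (P-+ p (b ℕ.∸ a) a))

P*-^ : ∀ p e z n → (P p e * z) ^ n ≡ P p (n ℕ.* e) * z ^ n
P*-^ p e z n = begin
  (P p e * z) ^ n         ≡⟨ ^-distrib-* (P p e) z n ⟩
  P p e ^ n * z ^ n       ≡⟨ cong (_* z ^ n) (ℤP.^-*-assoc (+ p) e n) ⟩
  P p (e ℕ.* n) * z ^ n   ≡⟨ cong (λ m → P p m * z ^ n) (ℕP.*-comm e n) ⟩
  P p (n ℕ.* e) * z ^ n   ∎
  where open ≡-Reasoning

^-mono-∣ : ∀ {a b} n → a ∣ₛ b → a ^ n ∣ₛ b ^ n
^-mono-∣ {a} n (divides q refl) = divides (q ^ n) (^-distrib-* q a n)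

P-pos : ∀ p a → P p a ≡ + (p ℕ.^ a)
P-pos p zero    = refl
P-pos p (suc a) = trans (cong (+ p *_) (P-pos p a)) (sym (ℤP.pos-* p (p ℕ.^ a)))

binomial-remainder : ∀ n .{{_ : ℕ.NonZero n}} x h →
                     Σ ℤ λ Q → (x + h) ^ n ≡ x ^ n + + n * (x ^ (n ℕ.∸ 1) * h) + h * h * Q
binomial-remainder (suc m) x h = go m
  where
  go : ∀ m → Σ ℤ λ Q → (x + h) ^ suc m ≡ x ^ suc m + + suc m * (x ^ m * h) + h * h * Q
  go zero    = 0ℤ , expand x h
    where
    expand : ∀ x h → (x + h) * 1ℤ ≡ x * 1ℤ + + 1 * (1ℤ * h) + h * h * 0ℤ
    expand = solve-∀
  go (suc m) with go m
  ... | Q , eq = + suc m * x ^ m + (x + h) * Q , trans (cong ((x + h) *_) eq) (expand x h (x ^ m) (+ suc m) Q)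
    where
    expand : ∀ x h X c Q → (x + h) * (x * X + c * (X * h) + h * h * Q)
           ≡ x * (x * X) + (1ℤ + c) * ((x * X) * h) + h * h * (c * X + (x + h) * Q)
    expand = solve-∀

-- `vpℕ` runs a fuel-driven helper that is local to its where-block. The meta `vpℕ-loop`
-- is solved by unification against that helper in `vpℕ-unfold`, which lets us reason
-- about it by induction on the fuel.
mutual
  vpℕ-loop : ℕ → ℕ → ℕ → ℕ → ℕ
  vpℕ-loop = _

  vpℕ-unfold : ∀ q n → suc q ℕD.∣ suc n →
               vpℕ (suc q) (suc n) ≡ suc (vpℕ-loop (suc q) (suc n) n (suc n ℕ./ suc q))
  vpℕ-unfold q n p∣n with suc q ℕD.∣? suc n
  ... | no p∤n = ⊥-elim (p∤n p∣n)
  ... | yes _ with suc n ℕ./ suc q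
  ... | d with suc n
  ... | m with suc q
  ... | p = refl

vpℕ-loop-factor : ∀ q b f m → let p = suc (suc q) in 1 ℕ.≤ m → m ℕ.≤ f →
                  ∃ λ m' → m ≡ p ℕ.^ vpℕ-loop p b f m ℕ.* m' × ¬ p ℕD.∣ m'
vpℕ-loop-factor q b zero m 1≤m m≤0 with ℕP.≤-trans 1≤m m≤0
... | ()
vpℕ-loop-factor q b (suc f) m 1≤m m≤f with suc (suc q) ℕD.∣? m
... | no p∤m = m , sym (ℕP.*-identityˡ m) , p∤m
... | yes (ℕD.divides zero refl) = ⊥-elim (ℕP.<-irrefl refl 1≤m)
... | yes (ℕD.divides (suc k) refl) rewrite ℕDM.m*n/n≡m (suc k) (suc (suc q)) ⦃ _ ⦄
  with vpℕ-loop-factor q b f (suc k) (s≤s z≤n)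
         (ℕP.≤-pred (ℕP.≤-trans (ℕP.m<m*n (suc k) (suc (suc q)) (s≤s (s≤s z≤n))) m≤f))
...   | m' , k≡ , p∤m' = m' , trans (cong (ℕ._* p) k≡) (rearrange (p ℕ.^ vpℕ-loop p b f (suc k)) m') , p∤m'
  where
  p = suc (suc q)
  rearrange : ∀ x y → x ℕ.* y ℕ.* p ≡ p ℕ.* x ℕ.* y
  rearrange x y = trans (ℕP.*-comm (x ℕ.* y) p) (sym (ℕP.*-assoc p x y))

vpℕ-factor : ∀ p → 1 ℕ.< p → ∀ n → 1 ℕ.≤ n →
             ∃ λ n' → n ≡ p ℕ.^ vpℕ p n ℕ.* n' × ¬ p ℕD.∣ n'
vpℕ-factor (suc zero) (s≤s ())
vpℕ-factor (suc (suc q)) _ n 1≤n = vpℕ-loop-factor q n n n 1≤n ℕP.≤-refl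

res-spec : ∀ n .{{_ : ℕ.NonZero n}} a → res n a ≡ a %ℕ n
res-spec (suc n) a = refl

module _ (n : ℕ) .{{_ : ℕ.NonZero n}} where

  ≤∧≡-mod⇒+* : ∀ {a b} → b ℕ.≤ a → + a ≡ + b mod + n → ∃ λ d → a ≡ b ℕ.+ n ℕ.* d
  ≤∧≡-mod⇒+* {a} {b} b≤a (≡-mod n∣a-b) with ∣⇒∣ᵤ n∣a-b
  ... | ℕD.divides d a-b≡ = d , (begin
    a                       ≡⟨ ℕP.m+[n∸m]≡n b≤a ⟨
    b ℕ.+ (a ℕ.∸ b)         ≡⟨ cong (b ℕ.+_) (trans (sym ∣a-b∣≡) a-b≡) ⟩
    b ℕ.+ d ℕ.* n           ≡⟨ cong (b ℕ.+_) (ℕP.*-comm d n) ⟩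
    b ℕ.+ n ℕ.* d           ∎)
    where
    open ≡-Reasoning
    ∣a-b∣≡ : ℤ.∣ + a - + b ∣ ≡ a ℕ.∸ b
    ∣a-b∣≡ = trans (cong ℤ.∣_∣ (ℤP.m-n≡m⊖n a b)) (trans (ℤP.∣m⊖n∣≡∣n⊖m∣ a b) (ℤP.∣⊖∣-≤ b≤a))

  <-≡-mod⇒≡ : ∀ {x y} → x ℕ.< n → y ℕ.< n → + x ≡ + y mod + n → x ≡ y
  <-≡-mod⇒≡ {x} {y} x<n y<n x≡y = Sum.[_,_]′ (λ x≤y → sym (ordered x≤y y<n (≡-mod-sym x≡y)))
                                          (λ y≤x → ordered y≤x x<n x≡y) (ℕP.≤-total x y)
    where
    ordered : ∀ {a b} → b ℕ.≤ a → a ℕ.< n → + a ≡ + b mod + n → a ≡ b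
    ordered {a} {b} b≤a a<n a≡b with ≤∧≡-mod⇒+* b≤a a≡b
    ... | zero  , a≡ = trans a≡ (trans (cong (b ℕ.+_) (ℕP.*-zeroʳ n)) (ℕP.+-identityʳ b))
    ... | suc d , a≡ = ⊥-elim (ℕP.<⇒≱ a<n (begin
      n                      ≤⟨ ℕP.m≤m*n n (suc d) ⟩
      n ℕ.* suc d            ≤⟨ ℕP.m≤n+m (n ℕ.* suc d) b ⟩
      b ℕ.+ n ℕ.* suc d      ≡⟨ a≡ ⟨
      a                      ∎))
      where open ℕP.≤-Reasoning

  res<n : ∀ a → res n a ℕ.< n
  res<n a = subst (ℕ._< n) (sym (res-spec n a)) (ℤDM.n%ℕd<d a n)

  ≡-mod-res : ∀ a → a ≡ + res n a mod + n
  ≡-mod-res a = ≡-mod (divides (a /ℕ n) (begin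
    a - + res n a                             ≡⟨ cong (λ r → a - + r) (res-spec n a) ⟩
    a - + (a %ℕ n)                            ≡⟨ cong (_- + (a %ℕ n)) (ℤDM.a≡a%ℕn+[a/ℕn]*n a n) ⟩
    + (a %ℕ n) + (a /ℕ n) * + n - + (a %ℕ n)  ≡⟨ cancel (+ (a %ℕ n)) ((a /ℕ n) * + n) ⟩
    (a /ℕ n) * + n                            ∎))
    where
    open ≡-Reasoning
    cancel : ∀ r t → r + t - r ≡ t
    cancel = solve-∀

  ≡-mod⇒res≡ : ∀ {a b} → a ≡ b mod + n → res n a ≡ res n b
  ≡-mod⇒res≡ {a} {b} a≡b = <-≡-mod⇒≡ (res<n a) (res<n b)
    (≡-mod-trans (≡-mod-sym (≡-mod-res a)) (≡-mod-trans a≡b (≡-mod-res b)))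

  res≡⇒≡-mod : ∀ {a b} → res n a ≡ res n b → a ≡ b mod + n
  res≡⇒≡-mod {a} {b} ra≡rb =
    ≡-mod-trans (≡-mod-res a) (subst (λ r → + r ≡ b mod + n) (sym ra≡rb) (≡-mod-sym (≡-mod-res b)))

sum3 : (Fin 3 → ℤ) → ℤ
sum3 g = g f0 + g (fs f0) + g (fs (fs f0))

sum3-cong : ∀ {g h} → (∀ l → g l ≡ h l) → sum3 g ≡ sum3 h
sum3-cong g≡h = cong₂ _+_ (cong₂ _+_ (g≡h f0) (g≡h (fs f0))) (g≡h (fs (fs f0)))

sum3-cong-mod : ∀ g h {d} → (∀ l → g l ≡ h l mod d) → sum3 g ≡ sum3 h mod d
sum3-cong-mod g h g≡h = +-cong-mod (+-cong-mod (g≡h f0) (g≡h (fs f0))) (g≡h (fs (fs f0)))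

*-distribˡ-sum3 : ∀ c g → c * sum3 g ≡ sum3 (λ l → c * g l)
*-distribˡ-sum3 c g = distrib c (g f0) (g (fs f0)) (g (fs (fs f0)))
  where
  distrib : ∀ c a b e → c * (a + b + e) ≡ c * a + c * b + c * e
  distrib = solve-∀

∣-sum3-remaining : ∀ {d} g l → (∀ l' → l' ≢ l → d ∣ₛ g l') → d ∣ₛ sum3 g → d ∣ₛ g l
∣-sum3-remaining g f0 others d∣Σ =
  SD.∣m+n∣n⇒∣m (SD.∣m+n∣n⇒∣m d∣Σ (others (fs (fs f0)) λ ())) (others (fs f0) λ ())
∣-sum3-remaining g (fs f0) others d∣Σ =
  SD.∣m+n∣m⇒∣n (SD.∣m+n∣n⇒∣m d∣Σ (others (fs (fs f0)) λ ())) (others f0 λ ())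
∣-sum3-remaining g (fs (fs f0)) others d∣Σ =
  SD.∣m+n∣m⇒∣n d∣Σ (SD.∣m∣n⇒∣m+n (others f0 λ ()) (others (fs f0) λ ()))

argmin3 : (f : Fin 3 → ℕ) → Σ (Fin 3) λ l → ∀ l' → f l ℕ.≤ f l'
argmin3 f with ℕP.≤-total (f f0) (f (fs f0)) | ℕP.≤-total (f f0) (f (fs (fs f0)))
                | ℕP.≤-total (f (fs f0)) (f (fs (fs f0)))
... | inj₁ 0≤1 | inj₁ 0≤2 | _        =
  f0 , λ { f0 → ℕP.≤-refl ; (fs f0) → 0≤1 ; (fs (fs f0)) → 0≤2 }
... | inj₁ 0≤1 | inj₂ 2≤0 | _        =
  fs (fs f0) , λ { f0 → 2≤0 ; (fs f0) → ℕP.≤-trans 2≤0 0≤1 ; (fs (fs f0)) → ℕP.≤-refl }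
... | inj₂ 1≤0 | _        | inj₁ 1≤2 =
  fs f0 , λ { f0 → 1≤0 ; (fs f0) → ℕP.≤-refl ; (fs (fs f0)) → 1≤2 }
... | inj₂ 1≤0 | _        | inj₂ 2≤1 =
  fs (fs f0) , λ { f0 → ℕP.≤-trans 2≤1 1≤0 ; (fs f0) → 2≤1 ; (fs (fs f0)) → ℕP.≤-refl }

≤-sum3 : ∀ (f : Fin 3 → ℕ) l → f l ℕ.≤ f f0 ℕ.+ f (fs f0) ℕ.+ f (fs (fs f0))
≤-sum3 f f0           = ℕP.≤-trans (ℕP.m≤m+n (f f0) (f (fs f0))) (ℕP.m≤m+n _ (f (fs (fs f0))))
≤-sum3 f (fs f0)      = ℕP.≤-trans (ℕP.m≤n+m (f (fs f0)) (f f0)) (ℕP.m≤m+n _ (f (fs (fs f0))))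
≤-sum3 f (fs (fs f0)) = ℕP.m≤n+m (f (fs (fs f0))) (f f0 ℕ.+ f (fs f0))

-- σ sends the positions 1, 2, 3 of the minimised triple to the chosen indices i, j, k
record Reindexing : Set where
  field
    σ τ    : Fin 3 → Fin 3
    σ-τ    : ∀ l → σ (τ l) ≡ l
    τ-σ    : ∀ l → τ (σ l) ≡ l
    sum3-σ : ∀ g → sum3 g ≡ sum3 (g ∘ σ)

identity swap₁₂ rotate : Reindexing
identity = record { σ = λ l → l ; τ = λ l → l ; σ-τ = λ _ → refl ; τ-σ = λ _ → refl ; sum3-σ = λ _ → refl }
swap₁₂ = record
  { σ = swap ; τ = swap ; σ-τ = involutive ; τ-σ = involutive
  ; sum3-σ = λ g → swap-last (g f0) (g (fs f0)) (g (fs (fs f0)))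
  }
  where
  swap : Fin 3 → Fin 3
  swap f0           = f0
  swap (fs f0)      = fs (fs f0)
  swap (fs (fs f0)) = fs f0
  involutive : ∀ l → swap (swap l) ≡ l
  involutive f0           = refl
  involutive (fs f0)      = refl
  involutive (fs (fs f0)) = refl
  swap-last : ∀ a b c → a + b + c ≡ a + c + b
  swap-last = solve-∀
rotate = record
  { σ = forward ; τ = backward ; σ-τ = forward-backward ; τ-σ = backward-forward
  ; sum3-σ = λ g → cycle (g f0) (g (fs f0)) (g (fs (fs f0)))
  }
  where
  forward backward : Fin 3 → Fin 3
  forward f0           = fs f0
  forward (fs f0)      = fs (fs f0)
  forward (fs (fs f0)) = f0
  backward f0           = fs (fs f0)
  backward (fs f0)      = f0
  backward (fs (fs f0)) = fs f0
  forward-backward : ∀ l → forward (backward l) ≡ l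
  forward-backward f0           = refl
  forward-backward (fs f0)      = refl
  forward-backward (fs (fs f0)) = refl
  backward-forward : ∀ l → backward (forward l) ≡ l
  backward-forward f0           = refl
  backward-forward (fs f0)      = refl
  backward-forward (fs (fs f0)) = refl
  cycle : ∀ a b c → a + b + c ≡ b + c + a
  cycle = solve-∀

IsZp-≤ : ∀ p x → IsZp p x → ∀ {a b} → a ℕ.≤ b → x b ≡ x a mod P p a
IsZp-≤ p x x-coh {a} {b} a≤b = subst (λ c → x c ≡ x a mod P p a) (ℕP.m∸n+n≡m a≤b) (go (b ℕ.∸ a))
  where
  go : ∀ d → x (d ℕ.+ a) ≡ x a mod P p a
  go zero    = ≡-mod-refl
  go (suc d) = ≡-mod-trans (≡-mod-∣ (P-mono-∣ p (ℕP.m≤n+m a d)) (≡-mod (∣ᵤ⇒∣ (x-coh (d ℕ.+ a))))) (go d)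

const-IsZp : ∀ p c → IsZp p (λ _ → c)
const-IsZp p c k = ∣⇒∣ᵤ (∣-difference (≡-mod-refl {P p k} {c}))

constℤₚ : ∀ {p} → ℤ → ℤₚ p
constℤₚ {p} c = mkℤₚ (λ _ → c) (const-IsZp p c)

digits : ∀ {p} → (Fin 3 → ℤₚ p) → ℕ → Fin 3 → ℤ
digits x k l = seq (x l) k

NonZeroTriple : ∀ {p} → (Fin 3 → ℤₚ p) → Set
NonZeroTriple {p} x = Σ (Fin 3) λ l → NonZeroZp p (seq (x l))

scale : ∀ {p} → ℕ → ℤₚ p → ℤₚ p
scale {p} s z = mkℤₚ (λ k → P p s * seq z k) scaled-coh
  where
  scaled-coh : IsZp p (λ k → P p s * seq z k)
  scaled-coh k = ∣⇒∣ᵤ (∣-difference (*-cong-mod (≡-mod-refl {P p k} {P p s}) (≡-mod (∣ᵤ⇒∣ (coh z k)))))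

module _ {p : ℕ} (p-prime : Prime p) where

  Unit : ℤ → Set
  Unit x = ¬ (+ p ∣ₛ x)

  p∣*⇒p∣⊎p∣ : ∀ {a b} → + p ∣ₛ a * b → + p ∣ₛ a ⊎ + p ∣ₛ b
  p∣*⇒p∣⊎p∣ {a} {b} p∣ab
    with euclidsLemma ℤ.∣ a ∣ ℤ.∣ b ∣ p-prime (subst (p ℕD.∣_) (ℤP.abs-* a b) (∣⇒∣ᵤ p∣ab))
  ... | inj₁ p∣a = inj₁ (∣ᵤ⇒∣ p∣a)
  ... | inj₂ p∣b = inj₂ (∣ᵤ⇒∣ p∣b)

  unit-* : ∀ {a b} → Unit a → Unit b → Unit (a * b)
  unit-* ua ub p∣ab with p∣*⇒p∣⊎p∣ p∣ab
  ... | inj₁ p∣a = ua p∣a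
  ... | inj₂ p∣b = ub p∣b

  unit-1 : Unit 1ℤ
  unit-1 p∣1 with ℕD.∣1⇒≡1 (∣⇒∣ᵤ p∣1) | prime⇒nonTrivial p-prime
  ... | refl | ()

  unit-^ : ∀ {a} → Unit a → ∀ n → Unit (a ^ n)
  unit-^ ua zero    = unit-1
  unit-^ ua (suc n) = unit-* ua (unit-^ ua n)

  unit-resp-≡-mod : ∀ {a b} → a ≡ b mod + p → Unit b → Unit a
  unit-resp-≡-mod a≡b ub p∣a = ub (∣-resp-≡-mod (≡-mod-sym a≡b) p∣a)

  P-nonZero : ∀ a → P p a ≢ 0ℤ
  P-nonZero a Pa≡0 with ℤP.i^n≡0⇒i≡0 (+ p) a Pa≡0 | prime⇒nonTrivial p-prime
  ... | refl | ()

  P-cancelˡ-∣ : ∀ a {x y} → P p a * x ∣ₛ P p a * y → x ∣ₛ y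
  P-cancelˡ-∣ a h = ∣ᵤ⇒∣ (UD.*-cancelˡ-∣ (P p a) ⦃ ℤ.≢-nonZero (P-nonZero a) ⦄ (∣⇒∣ᵤ h))

  p∣P : ∀ {a} → 1 ℕ.≤ a → + p ∣ₛ P p a
  p∣P {suc a} _ = SD.∣m⇒∣m*n (P p a) SD.∣-refl

  P∣⇒p∣ : ∀ {a x} → 1 ℕ.≤ a → P p a ∣ₛ x → + p ∣ₛ x
  P∣⇒p∣ 1≤a = SD.∣-trans (p∣P 1≤a)

  P-suc-∤-P*unit : ∀ a {z} → Unit z → ¬ (P p (suc a) ∣ₛ P p a * z)
  P-suc-∤-P*unit a {z} uz Pa+1∣ = uz (P-cancelˡ-∣ a (subst (_∣ₛ P p a * z) (ℤP.*-comm (+ p) (P p a)) Pa+1∣))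

  unit-inverseℕ : ∀ a → ¬ (p ℕD.∣ a) → Σ ℤ λ x → + a * x ≡ 1ℤ mod + p
  unit-inverseℕ a p∤a with ℕC.coprime-Bézout coprime
    where
    coprime : ℕC.Coprime a p
    coprime (d∣a , d∣p) with prime⇒irreducible p-prime d∣p
    ... | inj₁ d≡1 = d≡1
    ... | inj₂ refl = ⊥-elim (p∤a d∣a)
  ... | ℕG.Bézout.+- x y 1+yp≡xa = + x , ≡-mod (divides (+ y) (begin
    + a * + x - 1ℤ          ≡⟨ cong (_- 1ℤ) (trans (sym (ℤP.pos-* a x)) (cong +_ (trans (ℕP.*-comm a x) (sym 1+yp≡xa)))) ⟩
    + (1 ℕ.+ y ℕ.* p) - 1ℤ  ≡⟨ cong (λ t → 1ℤ + t - 1ℤ) (ℤP.pos-* y p) ⟩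
    1ℤ + + y * + p - 1ℤ     ≡⟨ cancel (+ y * + p) ⟩
    + y * + p               ∎))
    where
    open ≡-Reasoning
    cancel : ∀ t → 1ℤ + t - 1ℤ ≡ t
    cancel = solve-∀
  ... | ℕG.Bézout.-+ x y 1+xa≡yp = - + x , ≡-mod (divides (- + y) (begin
    + a * - + x - 1ℤ        ≡⟨ negate-sum (+ a) (+ x) ⟩
    - (1ℤ + + x * + a)      ≡⟨ cong (λ t → - (1ℤ + t)) (sym (ℤP.pos-* x a)) ⟩
    - + (1 ℕ.+ x ℕ.* a)     ≡⟨ cong (λ t → - + t) 1+xa≡yp ⟩
    - + (y ℕ.* p)           ≡⟨ cong -_ (ℤP.pos-* y p) ⟩
    - (+ y * + p)           ≡⟨ ℤP.neg-distribˡ-* (+ y) (+ p) ⟩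
    - + y * + p             ∎))
    where
    open ≡-Reasoning
    negate-sum : ∀ a x → a * - x - 1ℤ ≡ - (1ℤ + x * a)
    negate-sum = solve-∀

  unit-inverse : ∀ w → Unit w → Σ ℤ λ w' → w * w' ≡ 1ℤ mod + p
  unit-inverse (+ a) uw = unit-inverseℕ a (λ p∣a → uw (∣ᵤ⇒∣ p∣a))
  unit-inverse -[1+ m ] uw with unit-inverseℕ (suc m) (λ p∣a → uw (∣ᵤ⇒∣ p∣a))
  ... | x , ≡-mod h = - x , ≡-mod (subst (+ p ∣ₛ_) (negate-both (+ suc m) x) h)
    where
    negate-both : ∀ a x → a * x - 1ℤ ≡ (- a) * (- x) - 1ℤ
    negate-both = solve-∀

  vpℕ-factorℤ : ∀ n → 1 ℕ.≤ n → Σ ℕ λ n' → + n ≡ P p (vpℕ p n) * + n' × Unit (+ n')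
  vpℕ-factorℤ n 1≤n with vpℕ-factor p (ℕ.nonTrivial⇒n>1 p {{prime⇒nonTrivial p-prime}}) n 1≤n
  ... | n' , n≡ , p∤n' = n' , n≡ℤ , λ p∣n' → p∤n' (∣⇒∣ᵤ p∣n')
    where
    n≡ℤ : + n ≡ P p (vpℕ p n) * + n'
    n≡ℤ = trans (cong +_ n≡) (trans (ℤP.pos-* (p ℕ.^ vpℕ p n) n') (cong (_* + n') (sym (P-pos p (vpℕ p n)))))

  record CappedSplit (c : ℕ) (y : ℤ) : Set where
    field
      exponent : ℕ
      cofactor : ℤ
      split    : y ≡ P p exponent * cofactor
      exact    : (exponent ℕ.< c × Unit cofactor) ⊎ exponent ≡ c

  capped-split : ∀ c y → CappedSplit c y
  capped-split zero y = record { exponent = 0 ; cofactor = y ; split = sym (ℤP.*-identityˡ y) ; exact = inj₂ refl }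
  capped-split (suc c) y with + p SD.∣? y
  ... | no p∤y = record
    { exponent = 0 ; cofactor = y ; split = sym (ℤP.*-identityˡ y) ; exact = inj₁ (s≤s z≤n , p∤y) }
  ... | yes (divides y/p y≡) = record
    { exponent = suc exponent
    ; cofactor = cofactor
    ; split    = trans y≡ (trans (cong (_* + p) split) (reassociate (P p exponent) cofactor (+ p)))
    ; exact    = Sum.map (λ { (e<c , u) → s≤s e<c , u }) (cong suc) exact
    }
    where
    open CappedSplit (capped-split c y/p)
    reassociate : ∀ a z b → (a * z) * b ≡ (b * a) * z
    reassociate = solve-∀

  unit-digits : (u : ℤₚˣ p) → ∀ k → Unit (seq (elt u) (suc k))
  unit-digits u k = unit-resp-≡-mod (≡-mod-∣ (p∣P ℕP.≤-refl) (IsZp-≤ p (seq (elt u)) (coh (elt u)) (s≤s z≤n)))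
    (λ p∣u₁ → unit u (∣⇒∣ᵤ (subst (_∣ₛ seq (elt u) 1) (sym (ℤP.*-identityʳ (+ p))) p∣u₁)))

  module Hensel (n : ℕ) .{{_ : ℕ.NonZero n}} (A B : Seq) (A-coh : IsZp p A) (B-coh : IsZp p B) (A₁-unit : Unit (A 1))
                (x₀ : ℤ) (x₀-unit : Unit x₀)
                (x₀-root : P p (2 ℕ.* vpℕ p n ℕ.+ 1) ∣ₛ
                             A (2 ℕ.* vpℕ p n ℕ.+ 1) * x₀ ^ n + B (2 ℕ.* vpℕ p n ℕ.+ 1))
                where
    v N : ℕ
    v = vpℕ p n
    N = 2 ℕ.* v ℕ.+ 1

    f : ℕ → ℤ → ℤ
    f M x = A M * x ^ n + B M

    f-≡ : ∀ {M M'} → M ℕ.≤ M' → ∀ x → f M' x ≡ f M x mod P p M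
    f-≡ M≤M' x = +-cong-mod (*-cong-mod (IsZp-≤ p A A-coh M≤M') ≡-mod-refl) (IsZp-≤ p B B-coh M≤M')

    n' : ℕ
    n' = proj₁ (vpℕ-factorℤ n (ℕ.>-nonZero⁻¹ n))

    n≡ : + n ≡ P p v * + n'
    n≡ = proj₁ (proj₂ (vpℕ-factorℤ n (ℕ.>-nonZero⁻¹ n)))

    w' : ℤ
    w' = proj₁ (unit-inverse (A 1 * + n' * x₀ ^ (n ℕ.∸ 1))
                  (unit-* (unit-* A₁-unit (proj₂ (proj₂ (vpℕ-factorℤ n (ℕ.>-nonZero⁻¹ n))))) (unit-^ x₀-unit (n ℕ.∸ 1))))

    w'-inverse : ∀ M x → 1 ℕ.≤ M → x ≡ x₀ mod + p → A M * + n' * x ^ (n ℕ.∸ 1) * w' ≡ 1ℤ mod + p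
    w'-inverse M x 1≤M x≡x₀ = ≡-mod-trans
      (*-cong-mod (*-cong-mod (*-cong-mod (≡-mod-∣ (p∣P ℕP.≤-refl) (IsZp-≤ p A A-coh 1≤M)) ≡-mod-refl)
                              (^-cong-mod x≡x₀ (n ℕ.∸ 1)))
                  ≡-mod-refl)
      (proj₂ (unit-inverse (A 1 * + n' * x₀ ^ (n ℕ.∸ 1)) _))

    Approx : ℕ → ℤ → Set
    Approx M x = P p M ∣ₛ f M x × x ≡ x₀ mod + p

    record Lift (M : ℕ) (x : ℤ) : Set where
      field
        point : ℤ
        approx : Approx (suc M) point
        close : point ≡ x mod P p (M ℕ.∸ v)

    v≤N : v ℕ.≤ N
    v≤N = ℕP.≤-trans (ℕP.m≤m+n v (v ℕ.+ 0)) (ℕP.m≤m+n (2 ℕ.* v) 1)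

    module NewtonStep (M : ℕ) (N≤M : N ℕ.≤ M) (x : ℤ) (root : P p M ∣ₛ f M x) (x≡x₀ : x ≡ x₀ mod + p) where
      δ : ℕ
      δ = M ℕ.∸ v

      δ+v≡M : δ ℕ.+ v ≡ M
      δ+v≡M = ℕP.m∸n+n≡m (ℕP.≤-trans v≤N N≤M)

      v<δ : suc v ℕ.≤ δ
      v<δ = ℕP.+-cancelʳ-≤ v (suc v) δ (subst₂ ℕ._≤_ N≡ (sym δ+v≡M) N≤M)
        where
        N≡ : N ≡ suc v ℕ.+ v
        N≡ = trans (ℕP.+-comm (2 ℕ.* v) 1) (cong (λ t → suc (v ℕ.+ t)) (ℕP.+-identityʳ v))

      M<δ+δ : suc M ℕ.≤ δ ℕ.+ δ
      M<δ+δ = subst (λ t → suc t ℕ.≤ δ ℕ.+ δ) δ+v≡M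
                (subst (ℕ._≤ δ ℕ.+ δ) (ℕP.+-suc δ v) (ℕP.+-monoʳ-≤ δ v<δ))

      c : ℤ
      c = SD._∣_.quotient (∣-resp-≡-mod (f-≡ (ℕP.n≤1+n M) x) root)

      f≡cP : f (suc M) x ≡ c * P p M
      f≡cP = SD._∣_.equality (∣-resp-≡-mod (f-≡ (ℕP.n≤1+n M) x) root)

      -- Newton's correction h = -f(x)/f'(x), with f'(x) = p^v · (A n' x^(n-1)) and w' inverting the unit factor
      y h : ℤ
      y = - (c * w')
      h = P p δ * y

      A₊ Q w : ℤ
      A₊ = A (suc M)
      Q = proj₁ (binomial-remainder n x h)
      w = A₊ * + n' * x ^ (n ℕ.∸ 1)

      expand : f (suc M) (x + h) ≡ (f (suc M) x + A₊ * (+ n * (x ^ (n ℕ.∸ 1) * h))) + A₊ * (h * h * Q)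
      expand = trans (cong (λ t → A₊ * t + B (suc M)) (proj₂ (binomial-remainder n x h)))
                     (distribute A₊ (x ^ n) (+ n * (x ^ (n ℕ.∸ 1) * h)) (h * h * Q) (B (suc M)))
        where
        distribute : ∀ a X Y Z b → a * (X + Y + Z) + b ≡ (a * X + b + a * Y) + a * Z
        distribute = solve-∀

      linear-term : f (suc M) x + A₊ * (+ n * (x ^ (n ℕ.∸ 1) * h)) ≡ P p M * (c * (1ℤ - w * w'))
      linear-term = begin
        f (suc M) x + A₊ * (+ n * (x ^ (n ℕ.∸ 1) * h))
          ≡⟨ cong₂ (λ a b → a + A₊ * (b * (x ^ (n ℕ.∸ 1) * h))) f≡cP n≡ ⟩
        c * P p M + A₊ * ((P p v * + n') * (x ^ (n ℕ.∸ 1) * (P p δ * - (c * w'))))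
          ≡⟨ cong (λ t → c * t + A₊ * ((P p v * + n') * (x ^ (n ℕ.∸ 1) * (P p δ * - (c * w'))))) (sym PvPδ≡PM) ⟩
        c * (P p v * P p δ) + A₊ * ((P p v * + n') * (x ^ (n ℕ.∸ 1) * (P p δ * - (c * w'))))
          ≡⟨ factor c (P p v) (P p δ) A₊ (+ n') (x ^ (n ℕ.∸ 1)) w' ⟩
        (P p v * P p δ) * (c * (1ℤ - w * w'))
          ≡⟨ cong (_* (c * (1ℤ - w * w'))) PvPδ≡PM ⟩
        P p M * (c * (1ℤ - w * w')) ∎
        where
        open ≡-Reasoning
        PvPδ≡PM : P p v * P p δ ≡ P p M
        PvPδ≡PM = trans (sym (P-+ p v δ)) (cong (P p) (trans (ℕP.+-comm v δ) δ+v≡M))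
        factor : ∀ c Pv Pδ a k X w' → c * (Pv * Pδ) + a * ((Pv * k) * (X * (Pδ * - (c * w'))))
                 ≡ (Pv * Pδ) * (c * (1ℤ - (a * k * X) * w'))
        factor = solve-∀

      linear-part : P p (suc M) ∣ₛ f (suc M) x + A₊ * (+ n * (x ^ (n ℕ.∸ 1) * h))
      linear-part = subst₂ _∣ₛ_ (ℤP.*-comm (P p M) (+ p)) (sym linear-term)
        (∣ᵤ⇒∣ (UD.*-monoʳ-∣ (P p M) (∣⇒∣ᵤ (SD.∣n⇒∣m*n c
          (∣-difference (≡-mod-sym (w'-inverse (suc M) x (s≤s z≤n) x≡x₀)))))))

      quadratic-part : P p (suc M) ∣ₛ A₊ * (h * h * Q)
      quadratic-part = subst (P p (suc M) ∣ₛ_) (regroup A₊ (P p δ) y Q)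
        (SD.∣m⇒∣m*n (A₊ * (y * y * Q)) (SD.∣-trans (P-mono-∣ p M<δ+δ) (SD.∣-reflexive (P-+ p δ δ))))
        where
        regroup : ∀ a Pδ y Q → (Pδ * Pδ) * (a * (y * y * Q)) ≡ a * ((Pδ * y) * (Pδ * y) * Q)
        regroup = solve-∀

      x+h≡x : x + h ≡ x mod P p δ
      x+h≡x = ≡-mod (subst (P p δ ∣ₛ_) (sym (cancel x h)) (SD.∣m⇒∣m*n y SD.∣-refl))
        where
        cancel : ∀ x h → (x + h) - x ≡ h
        cancel = solve-∀

      lifted : Lift M x
      lifted = record
        { point  = x + h
        ; approx = subst (P p (suc M) ∣ₛ_) (sym expand) (SD.∣m∣n⇒∣m+n linear-part quadratic-part)
                 , ≡-mod-trans (≡-mod-∣ (p∣P (ℕP.≤-trans (s≤s z≤n) v<δ)) x+h≡x) x≡x₀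
        ; close  = x+h≡x
        }

    lift : ∀ M → N ℕ.≤ M → ∀ x → Approx M x → Lift M x
    lift M N≤M x (root , x≡x₀) = NewtonStep.lifted M N≤M x root x≡x₀

    approximation : ∀ j → Σ ℤ (Approx (j ℕ.+ N))
    approximation zero    = x₀ , x₀-root , ≡-mod-refl
    approximation (suc j) = Lift.point next , Lift.approx next
      where
      next = lift (j ℕ.+ N) (ℕP.m≤n+m N j) (proj₁ (approximation j)) (proj₂ (approximation j))

    Y : Seq
    Y j = proj₁ (approximation j)

    Y-coh : IsZp p Y
    Y-coh k = ∣⇒∣ᵤ (∣-difference (≡-mod-∣ (P-mono-∣ p k≤k+N-v) (Lift.close next)))
      where
      next = lift (k ℕ.+ N) (ℕP.m≤n+m N k) (proj₁ (approximation k)) (proj₂ (approximation k))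
      k≤k+N-v : k ℕ.≤ k ℕ.+ N ℕ.∸ v
      k≤k+N-v = subst (k ℕ.≤_) (sym (ℕP.+-∸-assoc k v≤N)) (ℕP.m≤m+n k (N ℕ.∸ v))

    Y-root : ∀ k → P p k ∣ₛ f k (Y k)
    Y-root k = ∣-resp-≡-mod (≡-mod-sym (f-≡ (ℕP.m≤m+n k N) (Y k)))
                 (SD.∣-trans (P-mono-∣ p (ℕP.m≤m+n k N)) (proj₁ (proj₂ (approximation k))))

    Y-unit : ∀ k → Unit (Y k)
    Y-unit k = unit-resp-≡-mod (proj₂ (proj₂ (approximation k))) x₀-unit

  hensel : ∀ n .{{_ : ℕ.NonZero n}} (A B : Seq) → IsZp p A → IsZp p B → Unit (A 1) → ∀ x₀ → Unit x₀ →
           let N = 2 ℕ.* vpℕ p n ℕ.+ 1 in P p N ∣ₛ A N * x₀ ^ n + B N →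
           Σ Seq λ Y → IsZp p Y × (∀ k → P p k ∣ₛ A k * Y k ^ n + B k) × (∀ k → Unit (Y k))
  hensel n A B A-coh B-coh A₁-unit x₀ x₀-unit x₀-root = Y , Y-coh , Y-root , Y-unit
    where open Hensel n A B A-coh B-coh A₁-unit x₀ x₀-unit x₀-root

  module _ (n : ℕ) .{{_ : ℕ.NonZero n}} where

    form : (Fin 3 → ℕ) → (Fin 3 → ℤ) → (Fin 3 → ℤ) → ℤ
    form e u x = sum3 (λ l → P p (e l) * (u l * x l ^ n))

    form-cong : ∀ e u {x y} → (∀ l → x l ≡ y l) → form e u x ≡ form e u y
    form-cong e u x≡y = sum3-cong (λ l → cong (λ t → P p (e l) * (u l * t ^ n)) (x≡y l))

    form-cong-mod : ∀ e {u u'} x {d} → (∀ l → u l ≡ u' l mod d) → form e u x ≡ form e u' x mod d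
    form-cong-mod e {u} {u'} x u≡u' =
      sum3-cong-mod (λ l → P p (e l) * (u l * x l ^ n)) (λ l → P p (e l) * (u' l * x l ^ n))
        λ l → *-cong-mod (≡-mod-refl {a = P p (e l)}) (*-cong-mod (u≡u' l) (≡-mod-refl {a = x l ^ n}))

    form-rescale : ∀ {H G} (e e' s : Fin 3 → ℕ) (u x : Fin 3 → ℤ) →
                   (∀ l → H ℕ.+ e l ℕ.+ n ℕ.* s l ≡ G ℕ.+ e' l) →
                   P p H * form e u (λ l → P p (s l) * x l) ≡ P p G * form e' u x
    form-rescale {H} {G} e e' s u x exps = begin
      P p H * form e u (λ l → P p (s l) * x l)
        ≡⟨ *-distribˡ-sum3 (P p H) (λ l → P p (e l) * (u l * (P p (s l) * x l) ^ n)) ⟩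
      sum3 (λ l → P p H * (P p (e l) * (u l * (P p (s l) * x l) ^ n)))
        ≡⟨ sum3-cong term ⟩
      sum3 (λ l → P p G * (P p (e' l) * (u l * x l ^ n)))
        ≡⟨ *-distribˡ-sum3 (P p G) (λ l → P p (e' l) * (u l * x l ^ n)) ⟨
      P p G * form e' u x ∎
      where
      open ≡-Reasoning
      term : ∀ l → P p H * (P p (e l) * (u l * (P p (s l) * x l) ^ n)) ≡ P p G * (P p (e' l) * (u l * x l ^ n))
      term l = begin
        P p H * (P p (e l) * (u l * (P p (s l) * x l) ^ n))
          ≡⟨ cong (λ y → P p H * (P p (e l) * (u l * y))) (P*-^ p (s l) (x l) n) ⟩
        P p H * (P p (e l) * (u l * (P p (n ℕ.* s l) * x l ^ n)))
          ≡⟨ regroup (P p H) (P p (e l)) (P p (n ℕ.* s l)) (u l) (x l ^ n) ⟩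
        (P p H * P p (e l) * P p (n ℕ.* s l)) * (u l * x l ^ n)
          ≡⟨ cong (_* (u l * x l ^ n)) (sym (trans (P-+ p (H ℕ.+ e l) (n ℕ.* s l))
                                                   (cong (_* P p (n ℕ.* s l)) (P-+ p H (e l))))) ⟩
        P p (H ℕ.+ e l ℕ.+ n ℕ.* s l) * (u l * x l ^ n)
          ≡⟨ cong (λ k → P p k * (u l * x l ^ n)) (exps l) ⟩
        P p (G ℕ.+ e' l) * (u l * x l ^ n)
          ≡⟨ trans (cong (_* (u l * x l ^ n)) (P-+ p G (e' l))) (ℤP.*-assoc (P p G) (P p (e' l)) (u l * x l ^ n)) ⟩
        P p G * (P p (e' l) * (u l * x l ^ n))   ∎
        where
        regroup : ∀ h e s u y → h * (e * (u * (s * y))) ≡ (h * e * s) * (u * y)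
        regroup = solve-∀

    Solves : (Fin 3 → ℕ) → (Fin 3 → ℤₚˣ p) → (Fin 3 → ℤₚ p) → Set
    Solves e u x = ∀ k → P p k ∣ₛ form e (digits (elt ∘ u) k) (digits x k)

    Solves-rescale : ∀ {G} (e e' s : Fin 3 → ℕ) u z → (∀ l → e l ℕ.+ n ℕ.* s l ≡ G ℕ.+ e' l) →
                     Solves e' u z → Solves e u (λ l → scale (s l) (z l))
    Solves-rescale {G} e e' s u z exps sol k =
      subst (P p k ∣ₛ_) (trans (sym rescaled) (ℤP.*-identityˡ _)) (SD.∣n⇒∣m*n (P p G) (sol k))
      where
      rescaled = form-rescale {0} e e' s (digits (elt ∘ u) k) (digits z k) exps

    scale-nonZero : ∀ s z → (∀ k → Unit (seq z k)) → NonZeroZp p (seq (scale s z))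
    scale-nonZero s z z-unit = suc s , λ h → P-suc-∤-P*unit s (z-unit (suc s)) (∣ᵤ⇒∣ h)

    form-updateAt : ∀ e u x q X → form e u (updateAt x q (λ _ → X)) ≡
                    (P p (e q) * u q) * X ^ n + (form e u x - (P p (e q) * u q) * x q ^ n)
    form-updateAt e u x f0 X =
      regroup (P p (e f0)) (u f0) (X ^ n) (x f0 ^ n)
        (P p (e (fs f0)) * (u (fs f0) * x (fs f0) ^ n)) (P p (e (fs (fs f0))) * (u (fs (fs f0)) * x (fs (fs f0)) ^ n))
      where
      regroup : ∀ a u X Y t₁ t₂ → a * (u * X) + t₁ + t₂ ≡ (a * u) * X + (a * (u * Y) + t₁ + t₂ - (a * u) * Y)
      regroup = solve-∀
    form-updateAt e u x (fs f0) X =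
      regroup (P p (e (fs f0))) (u (fs f0)) (X ^ n) (x (fs f0) ^ n)
        (P p (e f0) * (u f0 * x f0 ^ n)) (P p (e (fs (fs f0))) * (u (fs (fs f0)) * x (fs (fs f0)) ^ n))
      where
      regroup : ∀ a u X Y t₀ t₂ → t₀ + a * (u * X) + t₂ ≡ (a * u) * X + (t₀ + a * (u * Y) + t₂ - (a * u) * Y)
      regroup = solve-∀
    form-updateAt e u x (fs (fs f0)) X =
      regroup (P p (e (fs (fs f0)))) (u (fs (fs f0))) (X ^ n) (x (fs (fs f0)) ^ n)
        (P p (e f0) * (u f0 * x f0 ^ n)) (P p (e (fs f0)) * (u (fs f0) * x (fs f0) ^ n))
      where
      regroup : ∀ a u X Y t₀ t₁ → t₀ + t₁ + a * (u * X) ≡ (a * u) * X + (t₀ + t₁ + a * (u * Y) - (a * u) * Y)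
      regroup = solve-∀

    b-exponents : ℕ → Fin 3 → ℕ
    b-exponents r f0           = 0
    b-exponents r (fs f0)      = 0
    b-exponents r (fs (fs f0)) = r

    -- Valuations at level L are only computed up to the cap c. It exceeds the valuation
    -- w i₀ < K of the nonzero coordinate, so a capped term never has the least valuation.
    module LargeLevel (e : Fin 3 → ℕ) (u : Fin 3 → ℤₚˣ p) (x : Fin 3 → ℤₚ p) (root : Solves e u x)
                      (i₀ : Fin 3) (K : ℕ) (x-i₀-nonzero : ¬ (P p K ∣ₛ seq (x i₀) K)) (N : ℕ) where
      c L₀ L : ℕ
      c = e i₀ ℕ.+ K
      L₀ = n ℕ.* c ℕ.+ N
      L = suc L₀

      nc≤L : n ℕ.* c ℕ.≤ L
      nc≤L = ℕP.≤-trans (ℕP.m≤m+n (n ℕ.* c) N) (ℕP.n≤1+n L₀)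

      split : ∀ l → CappedSplit c (seq (x l) L)
      split l = capped-split c (seq (x l) L)

      w : Fin 3 → ℕ
      w l = CappedSplit.exponent (split l)

      z : Fin 3 → ℤ
      z l = CappedSplit.cofactor (split l)

      T : Fin 3 → ℕ
      T l = e l ℕ.+ n ℕ.* w l

      uL : Fin 3 → ℤ
      uL l = seq (elt (u l)) L

      root-at-L : P p L ∣ₛ form T uL z
      root-at-L = subst (P p L ∣ₛ_) (trans (form-cong e uL (λ l → CappedSplit.split (split l))) unscaled) (root L)
        where
        unscaled : form e uL (λ l → P p (w l) * z l) ≡ form T uL z
        unscaled = trans (sym (ℤP.*-identityˡ _))
                    (trans (form-rescale {0} {0} e T w uL z (λ l → refl)) (ℤP.*-identityˡ _))

      T≡e : ∀ l → + T l ≡ + e l mod + n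
      T≡e l = ≡-mod (divides (+ w l) (begin
        + (e l ℕ.+ n ℕ.* w l) - + e l
          ≡⟨ cong (_- + e l) (trans (ℤP.pos-+ (e l) (n ℕ.* w l)) (cong (_+_ (+ e l)) (ℤP.pos-* n (w l)))) ⟩
        + e l + + n * + w l - + e l      ≡⟨ cancel (+ e l) (+ n) (+ w l) ⟩
        + w l * + n                      ∎))
        where
        open ≡-Reasoning
        cancel : ∀ a n w → a + n * w - a ≡ w * n
        cancel = solve-∀

      w-i₀<K : w i₀ ℕ.< K
      w-i₀<K with K ℕ.≤? w i₀
      ... | no K≰w  = ℕP.≰⇒> K≰w
      ... | yes K≤w =
        ⊥-elim (x-i₀-nonzero (∣-resp-≡-mod (≡-mod-sym (IsZp-≤ p (seq (x i₀)) (coh (x i₀)) K≤L)) PK∣x-L))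
        where
        K≤L : K ℕ.≤ L
        K≤L = ℕP.≤-trans (ℕP.m≤n+m K (e i₀)) (ℕP.≤-trans (ℕP.m≤n*m c n) nc≤L)
        PK∣x-L : P p K ∣ₛ seq (x i₀) L
        PK∣x-L = subst (P p K ∣ₛ_) (sym (CappedSplit.split (split i₀))) (SD.∣m⇒∣m*n (z i₀) (P-mono-∣ p K≤w))

      T-i₀+n≤nc : T i₀ ℕ.+ n ℕ.≤ n ℕ.* c
      T-i₀+n≤nc = begin
        e i₀ ℕ.+ n ℕ.* w i₀ ℕ.+ n      ≡⟨ ℕP.+-assoc (e i₀) (n ℕ.* w i₀) n ⟩
        e i₀ ℕ.+ (n ℕ.* w i₀ ℕ.+ n)    ≡⟨ cong (e i₀ ℕ.+_) (trans (ℕP.+-comm (n ℕ.* w i₀) n) (sym (ℕP.*-suc n (w i₀)))) ⟩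
        e i₀ ℕ.+ n ℕ.* suc (w i₀)      ≤⟨ ℕP.+-mono-≤ (ℕP.m≤n*m (e i₀) n) (ℕP.*-monoʳ-≤ n w-i₀<K) ⟩
        n ℕ.* e i₀ ℕ.+ n ℕ.* K         ≡⟨ ℕP.*-distribˡ-+ n (e i₀) K ⟨
        n ℕ.* c                        ∎
        where open ℕP.≤-Reasoning

      T-i₀<nc : T i₀ ℕ.< n ℕ.* c
      T-i₀<nc = ℕP.<-≤-trans (ℕP.m<m+n (T i₀) (ℕ.>-nonZero⁻¹ n)) T-i₀+n≤nc

      below-cap-unit : ∀ l → T l ℕ.< n ℕ.* c → Unit (z l)
      below-cap-unit l T<nc with CappedSplit.exact (split l)
      ... | inj₁ (_ , unit) = unit
      ... | inj₂ w≡c = ⊥-elim (ℕP.<⇒≱ T<nc (subst (λ t → n ℕ.* t ℕ.≤ T l) w≡c (ℕP.m≤n+m (n ℕ.* w l) (e l))))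

      term-unit : ∀ l → Unit (z l) → Unit (uL l * z l ^ n)
      term-unit l z-unit = unit-* (unit-digits (u l) L₀) (unit-^ z-unit n)

      -- The T l are pairwise distinct, so the term of least valuation T ls is the only one
      -- not divisible by p^(T ls + 1).
      no-root-if-distinct : (∀ l l' → l ≢ l' → ¬ (+ e l ≡ + e l' mod + n)) → ⊥
      no-root-if-distinct distinct =
        P-suc-∤-P*unit (T ls) (term-unit ls (below-cap-unit ls (ℕP.≤-<-trans (minimal i₀) T-i₀<nc)))
          (∣-sum3-remaining (λ l → P p (T l) * (uL l * z l ^ n)) ls
            (λ l l≢ls → SD.∣m⇒∣m*n (uL l * z l ^ n) (P-mono-∣ p (others-larger l l≢ls)))
            (SD.∣-trans (P-mono-∣ p (ℕP.≤-<-trans (minimal i₀) (ℕP.<-≤-trans T-i₀<nc nc≤L))) root-at-L))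
        where
        ls = proj₁ (argmin3 T)
        minimal = proj₂ (argmin3 T)
        others-larger : ∀ l → l ≢ ls → T ls ℕ.< T l
        others-larger l l≢ls = ℕP.≤∧≢⇒< (minimal l) λ T-ls≡T-l → distinct l ls l≢ls
          (≡-mod-trans (≡-mod-sym (T≡e l)) (subst (λ t → + t ≡ + e ls mod + n) T-ls≡T-l (T≡e ls)))

      module Reduction (r : ℕ) (r<n : r ℕ.< n)
                       (compatible : ∀ l → + e l ≡ + e f0 + + b-exponents r l mod + n) where
        ρ : Fin 3 → ℕ
        ρ = b-exponents r

        ρ<n : ∀ l → ρ l ℕ.< n
        ρ<n f0           = ℕ.>-nonZero⁻¹ n
        ρ<n (fs f0)      = ℕ.>-nonZero⁻¹ n
        ρ<n (fs (fs f0)) = r<n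

        -- exponents after multiplying the equation by p^n, so that subtracting ρ l < n stays in ℕ
        A : Fin 3 → ℕ
        A l = T l ℕ.+ n ℕ.∸ ρ l

        A+ρ : ∀ l → A l ℕ.+ ρ l ≡ T l ℕ.+ n
        A+ρ l = ℕP.m∸n+n≡m (ℕP.≤-trans (ℕP.<⇒≤ (ρ<n l)) (ℕP.m≤n+m n (T l)))

        A≡e₀ : ∀ l → + A l ≡ + e f0 mod + n
        A≡e₀ l = ≡-mod (subst (+ n ∣ₛ_) (sym (trans (cong (_- + e f0) A≡) (regroup (+ T l) (+ e l) (+ e f0) (+ ρ l) (+ n))))
          (SD.∣m∣n⇒∣m+n (SD.∣m∣n⇒∣m+n (∣-difference (T≡e l)) (∣-difference (compatible l))) SD.∣-refl))
          where
          cancel : ∀ a b → a + b - b ≡ a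
          cancel = solve-∀
          A≡ : + A l ≡ + T l + + n - + ρ l
          A≡ = begin
            + A l                    ≡⟨ cancel (+ A l) (+ ρ l) ⟨
            + A l + + ρ l - + ρ l    ≡⟨ cong (_- + ρ l) (trans (sym (ℤP.pos-+ (A l) (ρ l))) (trans (cong +_ (A+ρ l)) (ℤP.pos-+ (T l) n))) ⟩
            + T l + + n - + ρ l      ∎
            where open ≡-Reasoning
          regroup : ∀ T e e₀ ρ n → T + n - ρ - e₀ ≡ (T - e) + (e - (e₀ + ρ)) + n
          regroup = solve-∀

        ls : Fin 3
        ls = proj₁ (argmin3 A)

        minimal : ∀ l → A ls ℕ.≤ A l
        minimal = proj₂ (argmin3 A)

        d : Fin 3 → ℕ
        d l = proj₁ (≤∧≡-mod⇒+* n (minimal l) (≡-mod-trans (A≡e₀ l) (≡-mod-sym (A≡e₀ ls))))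

        A≡ : ∀ l → A l ≡ A ls ℕ.+ n ℕ.* d l
        A≡ l = proj₂ (≤∧≡-mod⇒+* n (minimal l) (≡-mod-trans (A≡e₀ l) (≡-mod-sym (A≡e₀ ls))))

        y : Fin 3 → ℤ
        y l = P p (d l) * z l

        A-ls≤nc : A ls ℕ.≤ n ℕ.* c
        A-ls≤nc = ℕP.≤-trans (minimal i₀) (ℕP.≤-trans (ℕP.m∸n≤m (T i₀ ℕ.+ n) (ρ i₀)) T-i₀+n≤nc)

        rescaled : P p (A ls) * form ρ uL y ≡ P p n * form T uL z
        rescaled = form-rescale {A ls} {n} ρ T d uL z λ l → begin
          A ls ℕ.+ ρ l ℕ.+ n ℕ.* d l    ≡⟨ swap-last (A ls) (ρ l) (n ℕ.* d l) ⟩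
          A ls ℕ.+ n ℕ.* d l ℕ.+ ρ l    ≡⟨ cong (ℕ._+ ρ l) (A≡ l) ⟨
          A l ℕ.+ ρ l                   ≡⟨ A+ρ l ⟩
          T l ℕ.+ n                     ≡⟨ ℕP.+-comm (T l) n ⟩
          n ℕ.+ T l                     ∎
          where
          open ≡-Reasoning
          swap-last : ∀ a b c → a ℕ.+ b ℕ.+ c ≡ a ℕ.+ c ℕ.+ b
          swap-last a b c = trans (ℕP.+-assoc a b c) (trans (cong (a ℕ.+_) (ℕP.+-comm b c)) (sym (ℕP.+-assoc a c b)))

        root-y : P p (L ℕ.+ n ℕ.∸ A ls) ∣ₛ form ρ uL y
        root-y = P-cancelˡ-∣ (A ls) (subst₂ _∣ₛ_ P≡ (sym rescaled)
                   (∣ᵤ⇒∣ (UD.*-monoʳ-∣ (P p n) (∣⇒∣ᵤ root-at-L))))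
          where
          P≡ : P p n * P p L ≡ P p (A ls) * P p (L ℕ.+ n ℕ.∸ A ls)
          P≡ = begin
            P p n * P p L                      ≡⟨ P-+ p n L ⟨
            P p (n ℕ.+ L)                      ≡⟨ cong (P p) (trans (ℕP.+-comm n L) (sym (ℕP.m+[n∸m]≡n A≤L+n))) ⟩
            P p (A ls ℕ.+ (L ℕ.+ n ℕ.∸ A ls))  ≡⟨ P-+ p (A ls) (L ℕ.+ n ℕ.∸ A ls) ⟩
            P p (A ls) * P p (L ℕ.+ n ℕ.∸ A ls) ∎
            where
            open ≡-Reasoning
            A≤L+n = ℕP.≤-trans A-ls≤nc (ℕP.≤-trans nc≤L (ℕP.m≤m+n L n))

        below-precision : ∀ {b} → A ls ℕ.+ b ℕ.≤ L ℕ.+ n → b ℕ.≤ L ℕ.+ n ℕ.∸ A ls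
        below-precision {b} A+b≤ = subst (ℕ._≤ L ℕ.+ n ℕ.∸ A ls) (ℕP.m+n∸m≡n (A ls) b) (ℕP.∸-monoˡ-≤ (A ls) A+b≤)

        reduced-root : P p N ∣ₛ form ρ (digits (elt ∘ u) N) y
        reduced-root = ∣-resp-≡-mod
                         (form-cong-mod ρ y λ l → ≡-mod-sym (IsZp-≤ p (seq (elt (u l))) (coh (elt (u l))) N≤L))
                         (SD.∣-trans (P-mono-∣ p (below-precision A+N≤L+n)) root-y)
          where
          N≤L : N ℕ.≤ L
          N≤L = ℕP.≤-trans (ℕP.m≤n+m N (n ℕ.* c)) (ℕP.n≤1+n L₀)
          A+N≤L+n : A ls ℕ.+ N ℕ.≤ L ℕ.+ n
          A+N≤L+n = ℕP.≤-trans (ℕP.+-monoˡ-≤ N A-ls≤nc) (ℕP.≤-trans (ℕP.n≤1+n L₀) (ℕP.m≤m+n L n))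

        y-ls-unit : Unit (y ls)
        y-ls-unit = subst (λ t → Unit (P p t * z ls)) (sym d-ls≡0)
                      (subst Unit (sym (ℤP.*-identityˡ (z ls))) (below-cap-unit ls T-ls<nc))
          where
          d-ls≡0 : d ls ≡ 0
          d-ls≡0 = ℕP.m*n≡0⇒m≡0 (d ls) n (trans (ℕP.*-comm (d ls) n)
                     (ℕP.+-cancelˡ-≡ (A ls) (n ℕ.* d ls) 0 (trans (sym (A≡ ls)) (sym (ℕP.+-identityʳ (A ls))))))
          T-ls<nc : T ls ℕ.< n ℕ.* c
          T-ls<nc = ℕP.+-cancelʳ-< n (T ls) (n ℕ.* c)
                      (subst (ℕ._< n ℕ.* c ℕ.+ n) (A+ρ ls) (ℕP.+-mono-≤-< A-ls≤nc (ρ<n ls)))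

        not-both-divisible : ∀ l → Unit (y l) → ¬ (+ p ∣ₛ y f0 × + p ∣ₛ y (fs f0))
        not-both-divisible f0           y₀-unit (p∣y₀ , _)    = y₀-unit p∣y₀
        not-both-divisible (fs f0)      y₁-unit (_ , p∣y₁)    = y₁-unit p∣y₁
        not-both-divisible (fs (fs f0)) y₂-unit (p∣y₀ , p∣y₁) =
          third-term-unit (P∣⇒p∣ (ℕP.m<n⇒0<n∸m r<n)
            (P-cancelˡ-∣ r (subst (_∣ₛ P p r * (uL (fs (fs f0)) * y (fs (fs f0)) ^ n)) Pn≡ third)))
          where
          third-term-unit : Unit (uL (fs (fs f0)) * y (fs (fs f0)) ^ n)
          third-term-unit = unit-* (unit-digits (u (fs (fs f0))) L₀) (unit-^ y₂-unit n)
          Pn≡ : P p n ≡ P p r * P p (n ℕ.∸ r)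
          Pn≡ = trans (cong (P p) (sym (ℕP.m+[n∸m]≡n (ℕP.<⇒≤ r<n)))) (P-+ p r (n ℕ.∸ r))
          others : ∀ l → l ≢ fs (fs f0) → P p n ∣ₛ P p (ρ l) * (uL l * y l ^ n)
          others f0           _  = SD.∣n⇒∣m*n (P p 0) (SD.∣n⇒∣m*n (uL f0) (^-mono-∣ n p∣y₀))
          others (fs f0)      _  = SD.∣n⇒∣m*n (P p 0) (SD.∣n⇒∣m*n (uL (fs f0)) (^-mono-∣ n p∣y₁))
          others (fs (fs f0)) ne = ⊥-elim (ne refl)
          third : P p n ∣ₛ P p r * (uL (fs (fs f0)) * y (fs (fs f0)) ^ n)
          third = ∣-sum3-remaining (λ l → P p (ρ l) * (uL l * y l ^ n)) (fs (fs f0)) others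
                    (SD.∣-trans (P-mono-∣ p (below-precision (ℕP.+-monoˡ-≤ n (ℕP.≤-trans A-ls≤nc nc≤L)))) root-y)

      reduction : ∀ r → r ℕ.< n → (∀ l → + e l ≡ + e f0 + + b-exponents r l mod + n) →
                  Σ (Fin 3 → ℤ) λ y → ¬ (+ p ∣ₛ y f0 × + p ∣ₛ y (fs f0))
                                      × P p N ∣ₛ form (b-exponents r) (digits (elt ∘ u) N) y
      reduction r r<n compatible = y , not-both-divisible ls y-ls-unit , reduced-root
        where open Reduction r r<n compatible

    val⁺ val⁻ : ℤ → ℕ
    val⁺ (+ v)     = v
    val⁺ -[1+ v ]  = 0
    val⁻ (+ v)     = 0
    val⁻ -[1+ v ]  = suc v

    val⁺-val⁻ : ∀ v → + val⁺ v ≡ v + + val⁻ v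
    val⁺-val⁻ (+ v)    = sym (ℤP.+-identityʳ (+ v))
    val⁺-val⁻ -[1+ v ] = sym (ℤP.n⊖n≡0 (suc v))

    toQ-numerator : ∀ (a : ℚₚˣ p) k → proj₁ (toQ p a) k ≡ P p (val⁺ (val a)) * seq (elt (upart a)) k
    toQ-numerator (mkℚₚˣ (+ v) u)    k = refl
    toQ-numerator (mkℚₚˣ -[1+ v ] u) k = sym (ℤP.*-identityˡ _)

    toQ-denominator : ∀ (a : ℚₚˣ p) → proj₂ (toQ p a) ≡ val⁻ (val a)
    toQ-denominator (mkℚₚˣ (+ v) u)    = refl
    toQ-denominator (mkℚₚˣ -[1+ v ] u) = refl

    powQ-numerator : ∀ x m k → proj₁ (powQ (x , m) n) k ≡ x k ^ n
    powQ-numerator x m k = go n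
      where
      go : ∀ j → proj₁ (powQ (x , m) j) k ≡ x k ^ j
      go zero    = refl
      go (suc j) = cong (x k *_) (go j)

    powQ-denominator : ∀ x m → proj₂ (powQ (x , m) n) ≡ n ℕ.* m
    powQ-denominator x m = go n
      where
      go : ∀ j → proj₂ (powQ (x , m) j) ≡ j ℕ.* m
      go zero    = refl
      go (suc j) = cong (m ℕ.+_) (go j)

    module Denominators (a : Fin 3 → ℚₚˣ p) where
      units : Fin 3 → ℤₚˣ p
      units l = upart (a l)

      den : (Fin 3 → ℕ) → Fin 3 → ℕ
      den m l = val⁻ (val (a l)) ℕ.+ n ℕ.* m l

      total : (Fin 3 → ℕ) → ℕ
      total m = den m f0 ℕ.+ den m (fs f0) ℕ.+ den m (fs (fs f0))

      -- exponent of p in the l-th term of the numerator of curveVal: its own numerator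
      -- exponent plus the denominator exponents of the two other terms
      exponents : (Fin 3 → ℕ) → Fin 3 → ℕ
      exponents m f0           = val⁺ (val (a f0)) ℕ.+ (den m (fs f0) ℕ.+ den m (fs (fs f0)))
      exponents m (fs f0)      = val⁺ (val (a (fs f0))) ℕ.+ (den m f0 ℕ.+ den m (fs (fs f0)))
      exponents m (fs (fs f0)) = val⁺ (val (a (fs (fs f0)))) ℕ.+ (den m f0 ℕ.+ den m (fs f0))

      curveVal-numerator : ∀ t k → proj₁ (curveVal p n a t) k ≡
                           form (exponents (proj₂ ∘ t)) (digits (elt ∘ units) k) (digits (proj₁ ∘ t) k)
      curveVal-numerator t k
        rewrite toQ-denominator (a f0) | toQ-denominator (a (fs f0)) | toQ-denominator (a (fs (fs f0)))
              | powQ-denominator (seq (proj₁ (t f0))) (proj₂ (t f0))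
              | powQ-denominator (seq (proj₁ (t (fs f0)))) (proj₂ (t (fs f0)))
              | powQ-denominator (seq (proj₁ (t (fs (fs f0))))) (proj₂ (t (fs (fs f0))))
        = common-denominator (α f0) (α (fs f0)) (α (fs (fs f0))) (den m f0) (den m (fs f0)) (den m (fs (fs f0)))
                             (y f0) (y (fs f0)) (y (fs (fs f0))) (term f0) (term (fs f0)) (term (fs (fs f0)))
        where
        m = proj₂ ∘ t
        α : Fin 3 → ℕ
        α l = val⁺ (val (a l))
        y : Fin 3 → ℤ
        y l = seq (elt (units l)) k * seq (proj₁ (t l)) k ^ n
        term : ∀ l → proj₁ (mulQ (toQ p (a l)) (powQ (rawOf (t l)) n)) k ≡ P p (α l) * y l
        term l = trans (cong₂ _*_ (toQ-numerator (a l) k) (powQ-numerator (seq (proj₁ (t l))) (proj₂ (t l)) k))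
                       (ℤP.*-assoc (P p (α l)) (seq (elt (units l)) k) (seq (proj₁ (t l)) k ^ n))
        common-denominator : ∀ {N₀ N₁ N₂} α₀ α₁ α₂ d₀ d₁ d₂ y₀ y₁ y₂ →
          N₀ ≡ P p α₀ * y₀ → N₁ ≡ P p α₁ * y₁ → N₂ ≡ P p α₂ * y₂ →
          (N₀ * P p d₁ + N₁ * P p d₀) * P p d₂ + N₂ * P p (d₀ ℕ.+ d₁)
          ≡ P p (α₀ ℕ.+ (d₁ ℕ.+ d₂)) * y₀ + P p (α₁ ℕ.+ (d₀ ℕ.+ d₂)) * y₁ + P p (α₂ ℕ.+ (d₀ ℕ.+ d₁)) * y₂
        common-denominator α₀ α₁ α₂ d₀ d₁ d₂ y₀ y₁ y₂ refl refl refl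
          rewrite P-+ p α₀ (d₁ ℕ.+ d₂) | P-+ p α₁ (d₀ ℕ.+ d₂) | P-+ p α₂ (d₀ ℕ.+ d₁)
                | P-+ p d₁ d₂ | P-+ p d₀ d₂ | P-+ p d₀ d₁
          = regroup (P p α₀) (P p α₁) (P p α₂) y₀ y₁ y₂ (P p d₀) (P p d₁) (P p d₂)
          where
          regroup : ∀ (a₀ a₁ a₂ y₀ y₁ y₂ D₀ D₁ D₂ : ℤ) →
            ((a₀ * y₀) * D₁ + (a₁ * y₁) * D₀) * D₂ + (a₂ * y₂) * (D₀ * D₁)
            ≡ (a₀ * (D₁ * D₂)) * y₀ + (a₁ * (D₀ * D₂)) * y₁ + (a₂ * (D₀ * D₁)) * y₂
          regroup = solve-∀

      exponents+den : ∀ m l → exponents m l ℕ.+ den m l ≡ val⁺ (val (a l)) ℕ.+ total m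
      exponents+den m f0           = regroup₀ (val⁺ (val (a f0))) (den m f0) (den m (fs f0)) (den m (fs (fs f0)))
        where
        regroup₀ : ∀ α d₀ d₁ d₂ → α ℕ.+ (d₁ ℕ.+ d₂) ℕ.+ d₀ ≡ α ℕ.+ (d₀ ℕ.+ d₁ ℕ.+ d₂)
        regroup₀ = ℕSolver.solve-∀
      exponents+den m (fs f0)      = regroup₁ (val⁺ (val (a (fs f0)))) (den m f0) (den m (fs f0)) (den m (fs (fs f0)))
        where
        regroup₁ : ∀ α d₀ d₁ d₂ → α ℕ.+ (d₀ ℕ.+ d₂) ℕ.+ d₁ ≡ α ℕ.+ (d₀ ℕ.+ d₁ ℕ.+ d₂)
        regroup₁ = ℕSolver.solve-∀
      exponents+den m (fs (fs f0)) = ℕP.+-assoc (val⁺ (val (a (fs (fs f0))))) (den m f0 ℕ.+ den m (fs f0)) (den m (fs (fs f0)))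

      exponents-≡-val : ∀ m l → + exponents m l ≡ val (a l) + + total m mod + n
      exponents-≡-val m l = ≡-mod (divides (- + m l) (begin
        + E - (v + + T)                          ≡⟨ regroup (+ E) (+ val⁻ v) (+ n) (+ m l) v (+ T) ⟩
        (+ E + (+ val⁻ v + + n * + m l)) - ((v + + val⁻ v) + + T) + - + m l * + n
          ≡⟨ cong₂ (λ s t → s - (t + + T) + - + m l * + n) E+den (sym (val⁺-val⁻ v)) ⟩
        (+ val⁺ v + + T) - (+ val⁺ v + + T) + - + m l * + n
          ≡⟨ cancel (+ val⁺ v + + T) (- + m l * + n) ⟩
        - + m l * + n                            ∎))
        where
        open ≡-Reasoning
        E = exponents m l
        T = total m
        v = val (a l)
        E+den : + E + (+ val⁻ v + + n * + m l) ≡ + val⁺ v + + T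
        E+den = begin
          + E + (+ val⁻ v + + n * + m l)   ≡⟨ cong (λ t → + E + (+ val⁻ v + t)) (ℤP.pos-* n (m l)) ⟨
          + E + (+ val⁻ v + + (n ℕ.* m l)) ≡⟨ cong (_+_ (+ E)) (ℤP.pos-+ (val⁻ v) (n ℕ.* m l)) ⟨
          + E + + den m l                  ≡⟨ ℤP.pos-+ E (den m l) ⟨
          + (E ℕ.+ den m l)                ≡⟨ cong +_ (exponents+den m l) ⟩
          + (val⁺ v ℕ.+ T)                 ≡⟨ ℤP.pos-+ (val⁺ v) T ⟩
          + val⁺ v + + T                   ∎
        regroup : ∀ E δ n m v T → E - (v + T) ≡ (E + (δ + n * m)) - ((v + δ) + T) + - m * n
        regroup = solve-∀
        cancel : ∀ s t → s - s + t ≡ t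
        cancel = solve-∀

    hensel-at : ∀ e u y q → e q ≡ 0 → Unit (y q) →
                let N = 2 ℕ.* vpℕ p n ℕ.+ 1 in P p N ∣ₛ form e (digits (elt ∘ u) N) y →
                Σ (Fin 3 → ℤₚ p) λ z → Solves e u z × (∀ k → Unit (seq (z q) k))
    hensel-at e u y q e-q≡0 y-q-unit root = z , z-solves , z-unit
      where
      -- A k * Y ^ n + B k is the form at level k with the q-th coordinate replaced by Y
      A B : Seq
      A = seq (scale (e q) (elt (u q)))
      B k = form e (digits (elt ∘ u) k) y - A k * y q ^ n

      form-step : ∀ k → form e (digits (elt ∘ u) (suc k)) y ≡ form e (digits (elt ∘ u) k) y mod P p k
      form-step k = form-cong-mod e y λ l → IsZp-≤ p (seq (elt (u l))) (coh (elt (u l))) (ℕP.n≤1+n k)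

      A-step : ∀ k → A (suc k) * y q ^ n ≡ A k * y q ^ n mod P p k
      A-step k = *-cong-mod (IsZp-≤ p A (coh (scale (e q) (elt (u q)))) (ℕP.n≤1+n k)) ≡-mod-refl

      B-coh : IsZp p B
      B-coh k = ∣⇒∣ᵤ (∣-difference (minus-cong-mod (form-step k) (A-step k)))

      A₁-unit : Unit (A 1)
      A₁-unit rewrite e-q≡0 = subst Unit (sym (ℤP.*-identityˡ _)) (unit-digits (u q) 0)

      cancel : ∀ a f → a + (f - a) ≡ f
      cancel = solve-∀

      N = 2 ℕ.* vpℕ p n ℕ.+ 1
      lifted = hensel n A B (coh (scale (e q) (elt (u q)))) B-coh A₁-unit (y q) y-q-unit
                 (subst (P p N ∣ₛ_) (sym (cancel (A N * y q ^ n) (form e (digits (elt ∘ u) N) y))) root)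
      Y = proj₁ lifted
      Yₚ = mkℤₚ Y (proj₁ (proj₂ lifted))

      z : Fin 3 → ℤₚ p
      z = updateAt (constℤₚ ∘ y) q (λ _ → Yₚ)

      z-solves : Solves e u z
      z-solves k = subst (P p k ∣ₛ_) (sym (begin
        form e (digits (elt ∘ u) k) (digits z k)
          ≡⟨ form-cong e (digits (elt ∘ u) k)
               (map-updateAt-local {f = λ w → seq w k} {g = λ _ → Yₚ} {h = λ _ → Y k} (constℤₚ ∘ y) q refl) ⟩
        form e (digits (elt ∘ u) k) (updateAt y q (λ _ → Y k))
          ≡⟨ form-updateAt e (digits (elt ∘ u) k) y q (Y k) ⟩
        A k * Y k ^ n + B k ∎)) (proj₁ (proj₂ (proj₂ lifted)) k)
        where open ≡-Reasoning

      z-unit : ∀ k → Unit (seq (z q) k)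
      z-unit k = subst (λ w → Unit (seq w k)) (sym (updateAt-updates q (constℤₚ ∘ y)))
                   (proj₂ (proj₂ (proj₂ lifted)) k)

    common-level : ∀ (e ρ : Fin 3 → ℕ) → (∀ l → + e l ≡ + e f0 + + ρ l mod + n) →
                   Σ ℕ λ G → Σ (Fin 3 → ℕ) λ s → ∀ l → e l ℕ.+ n ℕ.* s l ≡ G ℕ.+ ρ l
    common-level e ρ compatible = G , (λ l → proj₁ (shift l)) , (λ l → sym (proj₂ (shift l)))
      where
      S G : ℕ
      S = e f0 ℕ.+ e (fs f0) ℕ.+ e (fs (fs f0))
      G = e f0 ℕ.+ n ℕ.* S

      e≤G+ρ : ∀ l → e l ℕ.≤ G ℕ.+ ρ l
      e≤G+ρ l = ℕP.≤-trans (≤-sum3 e l)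
                  (ℕP.≤-trans (ℕP.m≤n*m S n) (ℕP.≤-trans (ℕP.m≤n+m (n ℕ.* S) (e f0)) (ℕP.m≤m+n G (ρ l))))

      G+ρ≡e : ∀ l → + (G ℕ.+ ρ l) ≡ + e l mod + n
      G+ρ≡e l = ≡-mod-trans (≡-mod (divides (+ S) (begin
        + (G ℕ.+ ρ l) - (+ e f0 + + ρ l)
          ≡⟨ cong (_- (+ e f0 + + ρ l)) (trans (ℤP.pos-+ G (ρ l)) (cong (_+ + ρ l)
               (trans (ℤP.pos-+ (e f0) (n ℕ.* S)) (cong (_+_ (+ e f0)) (ℤP.pos-* n S))))) ⟩
        + e f0 + + n * + S + + ρ l - (+ e f0 + + ρ l) ≡⟨ cancel (+ e f0) (+ n) (+ S) (+ ρ l) ⟩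
        + S * + n                                     ∎)))
        (≡-mod-sym (compatible l))
        where
        open ≡-Reasoning
        cancel : ∀ e n S ρ → e + n * S + ρ - (e + ρ) ≡ S * n
        cancel = solve-∀

      shift : ∀ l → ∃ λ s → G ℕ.+ ρ l ≡ e l ℕ.+ n ℕ.* s
      shift l = ≤∧≡-mod⇒+* n (e≤G+ρ l) (G+ρ≡e l)

    module _ (R : Reindexing) where
      open Reindexing R

      Solves-σ : ∀ e u x → Solves e u x → Solves (e ∘ σ) (u ∘ σ) (x ∘ σ)
      Solves-σ e u x sol k =
        subst (P p k ∣ₛ_) (sum3-σ (λ l → P p (e l) * (seq (elt (u l)) k * seq (x l) k ^ n))) (sol k)

      Solves-τ : ∀ e u z → Solves (e ∘ σ) (u ∘ σ) z → Solves e u (z ∘ τ)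
      Solves-τ e u z sol k = subst (P p k ∣ₛ_) (sym (begin
        form e (digits (elt ∘ u) k) (digits (z ∘ τ) k)
          ≡⟨ sum3-σ (λ l → P p (e l) * (seq (elt (u l)) k * seq (z (τ l)) k ^ n)) ⟩
        form (e ∘ σ) (digits (elt ∘ u ∘ σ) k) (digits (z ∘ τ ∘ σ) k)
          ≡⟨ form-cong (e ∘ σ) (digits (elt ∘ u ∘ σ) k) (λ l → cong (λ i → seq (z i) k) (τ-σ l)) ⟩
        form (e ∘ σ) (digits (elt ∘ u ∘ σ) k) (digits z k) ∎)) (sol k)
        where open ≡-Reasoning

    module _ (a : Fin 3 → ℚₚˣ p) where
      open Denominators a

      point-solves : (pt : HasQpPoint p n a) → Solves (exponents (proj₂ ∘ proj₁ pt)) units (proj₁ ∘ proj₁ pt)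
      point-solves (t , _ , curve≡0) k = subst (P p k ∣ₛ_) (curveVal-numerator t k) (∣ᵤ⇒∣ (curve≡0 k))

      solution⇒point : ∀ x → NonZeroTriple x → Solves (exponents (λ _ → 0)) units x → HasQpPoint p n a
      solution⇒point x nonzero sol = (λ l → x l , 0) , nonzero ,
        λ k → ∣⇒∣ᵤ (subst (P p k ∣ₛ_) (sym (curveVal-numerator (λ l → x l , 0) k)) (sol k))

      part-i : (∀ i j → i ≢ j → res n (val (a i)) ≢ res n (val (a j))) → ¬ HasQpPoint p n a
      part-i distinct pt@(t , (i₀ , K , nonzero) , _) =
        LargeLevel.no-root-if-distinct (exponents m) units (proj₁ ∘ t) (point-solves pt) i₀ K (nonzero ∘ ∣⇒∣ᵤ) 0
          exponents-distinct
        where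
        m = proj₂ ∘ t
        exponents-distinct : ∀ l l' → l ≢ l' → ¬ (+ exponents m l ≡ + exponents m l' mod + n)
        exponents-distinct l l' l≢l' E≡ = distinct l l' l≢l' (≡-mod⇒res≡ n (+-cancelʳ-≡-mod
          (≡-mod-trans (≡-mod-sym (exponents-≡-val m l)) (≡-mod-trans E≡ (exponents-≡-val m l')))))

      MinimisedSolvable : Fin 3 → Fin 3 → Fin 3 → Set
      MinimisedSolvable i j k = Σ (Fin 3 → ℤₚ p) λ t →
        (∀ (c : ℤ) → ¬ (P p 1 UD.∣ seq (t f0) 1 × P p 1 UD.∣ seq (t (fs f0)) 1
                         × P p 1 UD.∣ (seq (t (fs (fs f0))) 1 - c)))
        × P p (2 ℕ.* vpℕ p n ℕ.+ 1) UD.∣ minVal p n a i j k t (2 ℕ.* vpℕ p n ℕ.+ 1)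

      module PartII (R : Reindexing)
                    (same-residue : res n (val (a (Reindexing.σ R f0))) ≡ res n (val (a (Reindexing.σ R (fs f0)))))
                    where
        open Reindexing R

        i j k : Fin 3
        i = σ f0
        j = σ (fs f0)
        k = σ (fs (fs f0))

        r N : ℕ
        r = res n (val (a k) - val (a i))
        N = 2 ℕ.* vpℕ p n ℕ.+ 1

        ρ : Fin 3 → ℕ
        ρ = b-exponents r

        valuations : ∀ l → val (a (σ l)) ≡ val (a i) + + ρ l mod + n
        valuations f0           = ≡-mod-reflexive (sym (ℤP.+-identityʳ (val (a i))))
        valuations (fs f0)      = ≡-mod-trans (≡-mod-sym (res≡⇒≡-mod n same-residue))
                                              (≡-mod-reflexive (sym (ℤP.+-identityʳ (val (a i)))))
        valuations (fs (fs f0)) = x-y≡z⇒x≡y+z-mod (≡-mod-res n (val (a k) - val (a i)))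

        compatible : ∀ m l → + exponents m (σ l) ≡ + exponents m i + + ρ l mod + n
        compatible m l = ≡-mod-trans (exponents-≡-val m (σ l)) (≡-mod-trans (+-cong-mod (valuations l) ≡-mod-refl)
          (≡-mod-trans (≡-mod-reflexive (swap (val (a i)) (+ ρ l) (+ total m)))
                       (+-cong-mod (≡-mod-sym (exponents-≡-val m i)) ≡-mod-refl)))
          where
          swap : ∀ v ρ s → v + ρ + s ≡ v + s + ρ
          swap = solve-∀

        minVal≡form : ∀ t M → minVal p n a i j k t M ≡ form ρ (digits (elt ∘ units ∘ σ) M) (digits t M)
        minVal≡form t M = regroup (seq (elt (units i)) M) (seq (elt (units j)) M) (seq (elt (units k)) M)
                                  (seq (t f0) M ^ n) (seq (t (fs f0)) M ^ n) (seq (t (fs (fs f0))) M ^ n) (P p r)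
          where
          regroup : ∀ u₀ u₁ u₂ x₀ x₁ x₂ Pr →
                    u₀ * x₀ + u₁ * x₁ + (Pr * u₂) * x₂ ≡ 1ℤ * (u₀ * x₀) + 1ℤ * (u₁ * x₁) + Pr * (u₂ * x₂)
          regroup = solve-∀

        to : HasQpPoint p n a → MinimisedSolvable i j k
        to pt@(t , (i₀ , K , nonzero) , _) = constℤₚ ∘ y , condition ,
          ∣⇒∣ᵤ (subst (P p N ∣ₛ_) (sym (minVal≡form (constℤₚ ∘ y) N)) (proj₂ (proj₂ reduced)))
          where
          m = proj₂ ∘ t
          nonzero-σ : ¬ (P p K ∣ₛ seq (proj₁ (t (σ (τ i₀)))) K)
          nonzero-σ = subst (λ l → ¬ (P p K ∣ₛ seq (proj₁ (t l)) K)) (sym (σ-τ i₀)) (nonzero ∘ ∣⇒∣ᵤ)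
          reduced = LargeLevel.reduction (exponents m ∘ σ) (units ∘ σ) (proj₁ ∘ t ∘ σ)
                      (Solves-σ R (exponents m) units (proj₁ ∘ t) (point-solves pt))
                      (τ i₀) K nonzero-σ N r (res<n n (val (a k) - val (a i))) (compatible m)
          y = proj₁ reduced
          condition : ∀ (c : ℤ) → ¬ (P p 1 UD.∣ y f0 × P p 1 UD.∣ y (fs f0) × P p 1 UD.∣ (y (fs (fs f0)) - c))
          condition c (p∣y₀ , p∣y₁ , _) =
            proj₁ (proj₂ reduced) (P∣⇒p∣ ℕP.≤-refl (∣ᵤ⇒∣ p∣y₀) , P∣⇒p∣ ℕP.≤-refl (∣ᵤ⇒∣ p∣y₁))

        from : MinimisedSolvable i j k → HasQpPoint p n a
        from (t , condition , root) =
          solution⇒point x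
            (σ q , subst (λ l → NonZeroZp p (seq (scale (s l) (z l)))) (sym (τ-σ q)) (scale-nonZero (s q) (z q) z-unit))
            (Solves-τ R (exponents (λ _ → 0)) units (λ l → scale (s l) (z l))
              (Solves-rescale (exponents (λ _ → 0) ∘ σ) ρ s (units ∘ σ) z exps z-solves))
          where
          y = digits t N
          root-y : P p N ∣ₛ form ρ (digits (elt ∘ units ∘ σ) N) y
          root-y = subst (P p N ∣ₛ_) (minVal≡form t N) (∣ᵤ⇒∣ root)

          P1∣level-1 : ∀ (x : ℤₚ p) → + p ∣ₛ seq x N → P p 1 UD.∣ seq x 1
          P1∣level-1 x p∣x = ∣⇒∣ᵤ (subst (_∣ₛ seq x 1) (sym (ℤP.*-identityʳ (+ p)))
            (∣-resp-≡-mod (≡-mod-sym (≡-mod-∣ (p∣P ℕP.≤-refl) (IsZp-≤ p (seq x) (coh x) (ℕP.m≤n+m 1 (2 ℕ.* vpℕ p n)))))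
              p∣x))

          -- condition (1) with c the third digit forbids p dividing both t₁ and t₂
          unit-coordinate : Σ (Fin 3) λ q → ρ q ≡ 0 × Unit (y q)
          unit-coordinate with + p SD.∣? y f0 | + p SD.∣? y (fs f0)
          ... | no p∤y₀  | _         = f0 , refl , p∤y₀
          ... | yes _    | no p∤y₁   = fs f0 , refl , p∤y₁
          ... | yes p∣y₀ | yes p∣y₁ = ⊥-elim (condition (seq (t (fs (fs f0))) 1)
                (P1∣level-1 (t f0) p∣y₀ , P1∣level-1 (t (fs f0)) p∣y₁ ,
                 ∣⇒∣ᵤ (∣-difference (≡-mod-refl {P p 1} {seq (t (fs (fs f0))) 1}))))

          q = proj₁ unit-coordinate
          lifted = hensel-at ρ (units ∘ σ) y q (proj₁ (proj₂ unit-coordinate)) (proj₂ (proj₂ unit-coordinate))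
                     root-y
          z = proj₁ lifted
          z-solves = proj₁ (proj₂ lifted)
          z-unit = proj₂ (proj₂ lifted)

          level = common-level (exponents (λ _ → 0) ∘ σ) ρ (compatible (λ _ → 0))
          s = proj₁ (proj₂ level)
          exps = proj₂ (proj₂ level)

          x : Fin 3 → ℤₚ p
          x l = scale (s (τ l)) (z (τ l))

        equivalence : HasQpPoint p n a ⇔ MinimisedSolvable i j k
        equivalence = mk⇔ to from

      part-ii : ∀ i j k → i <ᶠ j → k ≢ i → k ≢ j → res n (val (a i)) ≡ res n (val (a j)) →
                HasQpPoint p n a ⇔ MinimisedSolvable i j k
      part-ii f0           (fs f0)      (fs (fs f0)) _ _   _   same = PartII.equivalence identity same
      part-ii f0           (fs (fs f0)) (fs f0)      _ _   _   same = PartII.equivalence swap₁₂ same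
      part-ii (fs f0)      (fs (fs f0)) f0           _ _   _   same = PartII.equivalence rotate same
      part-ii f0           f0           _            () _   _   _
      part-ii f0           (fs f0)      f0           _ k≢i _   _ = ⊥-elim (k≢i refl)
      part-ii f0           (fs f0)      (fs f0)      _ _   k≢j _ = ⊥-elim (k≢j refl)
      part-ii f0           (fs (fs f0)) f0           _ k≢i _   _ = ⊥-elim (k≢i refl)
      part-ii f0           (fs (fs f0)) (fs (fs f0)) _ _   k≢j _ = ⊥-elim (k≢j refl)
      part-ii (fs f0)      f0           _            () _   _   _
      part-ii (fs f0)      (fs f0)      _            (s≤s ()) _ _ _
      part-ii (fs f0)      (fs (fs f0)) (fs f0)      _ k≢i _   _ = ⊥-elim (k≢i refl)
      part-ii (fs f0)      (fs (fs f0)) (fs (fs f0)) _ _   k≢j _ = ⊥-elim (k≢j refl)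
      part-ii (fs (fs f0)) f0           _            () _   _   _
      part-ii (fs (fs f0)) (fs f0)      _            (s≤s ()) _ _ _
      part-ii (fs (fs f0)) (fs (fs f0)) _            (s≤s (s≤s ())) _ _ _

proposition2p5 :
    (n : ℕ) → 1 < n → (p : ℕ) → Prime p → (a : Fin 3 → ℚₚˣ p) →
    -- (i) three distinct residues of valuations mod n: no ℚ_p-point
    ((∀ i j → i ≢ j → res n (val (a i)) ≢ res n (val (a j))) → ¬ HasQpPoint p n a)
    ×
    -- (ii) for any choice i < j with equal residues, k the remaining index
    (∀ i j k → i <ᶠ j → k ≢ i → k ≢ j → res n (val (a i)) ≡ res n (val (a j)) →
      (HasQpPoint p n a ⇔
        (Σ (Fin 3 → ℤₚ p) λ t →
          (∀ (c : ℤ) → ¬ (P p 1 ∣ seq (t f0) 1 × P p 1 ∣ seq (t (fs f0)) 1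
                           × P p 1 ∣ (seq (t (fs (fs f0))) 1 - c)))
          × P p (2 Data.Nat.* vpℕ p n Data.Nat.+ 1) ∣ minVal p n a i j k t (2 Data.Nat.* vpℕ p n Data.Nat.+ 1))))
proposition2p5 n 1<n p p-prime a = part-i p-prime n a , part-ii p-prime n a
  where
  instance
    n≢0 : ℕ.NonZero n
    n≢0 = ℕ.>-nonZero (ℕP.<-trans (s≤s z≤n) 1<n)
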